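{- Let $k\ge 5$ be an integer and let $\Gamma^{(k)}$ be the graph defined below. For every $j\in\mathbb{Z}_{8k+4}$, writing $K=\{0,2k+1,2k+3\}$, the following hold: (i) $S_2(x_j)=\big((\pm2+j+\langle 2k+1\rangle)\cup(j+\langle 2k+1\rangle^*),\ \pm1+j+K\big)$; (ii) $S_3(x_j)=\big((\pm3+j+\langle 2k+1\rangle)\cup(\pm1+j+\langle 2k+1\rangle^*),\ (\pm3+j+1+\langle 2k+1\rangle)\cup\{j+2\}\big)$; (iii) $S_4(x_j)=\big(\pm4+j+\langle 2k+1\rangle,\ (\pm4+j+1+\langle 2k+1\rangle)\cup\{j+3\}\big)$; (iv) $S_i(x_j)=\big(\pm i+j+\langle 2k+1\rangle,\ \pm i+j+1+\langle 2k+1\rangle\big)$ for every $i\in\{5,\dots,k\}$; (v) $|S_2(x_j)|=16$, $|S_3(x_j)|=19$, $|S_4(x_j)|=13$ and $|S_i(x_j)|=12$ for every $5\le i\le k$; moreover the eccentricity of $x_j$ equals $k$.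
   Context: $\Gamma^{(k)}$ is the graph on $12k+6$ vertices $\{x_i\mid i\in\mathbb{Z}_{8k+4}\}\cup\{y_i\mid i\in\mathbb{Z}_{4k+2}\}$ with edges $x_i\sim x_{i+1}$ ($i\in\mathbb{Z}_{8k+4}$) and $y_i\sim x_{i+m}$ for $m\in M=\{0,2k-1,2k+1,4k+2,6k+1,6k+3\}$ (indices of $x$ modulo $8k+4$, indices of $y$ modulo $4k+2$; this is independent of the integer representative of $i$). A subset $X$ of the vertex set is written as a pair $(A,B)$ with $A=\{i\in\mathbb{Z}_{8k+4}\mid x_i\in X\}$ and $B=\{i\in\mathbb{Z}_{4k+2}\mid y_i\in X\}$; first-coordinate expressions are computed in $\mathbb{Z}_{8k+4}$ and second-coordinate expressions in $\mathbb{Z}_{4k+2}$. For $H$ a subset of $\mathbb{Z}_\ell$ and an integer $j$, $j+H=\{j+h\mid h\in H\}$; $\pm a+H$ means $(a+H)\cup(-a+H)$; $\langle h\rangle=\{nh\mid n\in\mathbb{Z}\}$ (in the relevant $\mathbb{Z}_\ell$) and $\langle h\rangle^*=\langle h\rangle\setminus\{0\}$. $S_i(u)$ is the set of vertices at distance $i$ from $u$, and the eccentricity of $u$ is the maximum distance from $u$ to a vertex. -}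

module Defs where

open import Data.Nat as ℕ using (ℕ; zero; suc; _≤_; _<_)
open import Data.Integer as ℤ using (ℤ; +_)
open import Data.Integer.DivMod using (_%ℕ_; n%ℕd<d)
open import Data.Fin as Fin using (Fin; fromℕ<)
open import Data.Sum using (_⊎_; inj₁; inj₂)
open import Data.Product using (Σ; ∃; ∃-syntax; _×_; _,_)
open import Data.List using (List; length)
open import Data.List.Membership.Propositional using (_∈_)
open import Data.List.Relation.Unary.Unique.Propositional using (Unique)
open import Relation.Binary.PropositionalEquality using (_≡_; _≢_)
open import Relation.Nullary using (¬_)
open import Function.Bundles using (_⇔_)

-- The cyclic group Z_ℓ, represented by Fin ℓ (residues 0..ℓ-1)

⟦_⟧ : ∀ {ℓ} .{{_ : ℕ.NonZero ℓ}} → ℤ → Fin ℓ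
⟦_⟧ {ℓ} z = fromℕ< (n%ℕd<d z ℓ)

rep : ∀ {ℓ} → Fin ℓ → ℤ
rep a = + (Fin.toℕ a)

Sub : ℕ → Set₁
Sub ℓ = Fin ℓ → Set

_∪_ : ∀ {ℓ} → Sub ℓ → Sub ℓ → Sub ℓ
(A ∪ B) a = A a ⊎ B a
infixr 5 _∪_

｛_｝ : ∀ {ℓ} .{{_ : ℕ.NonZero ℓ}} → ℤ → Sub ℓ
｛ c ｝ a = a ≡ ⟦ c ⟧

_+S_ : ∀ {ℓ} .{{_ : ℕ.NonZero ℓ}} → ℤ → Sub ℓ → Sub ℓ
(c +S H) a = ∃[ h ] (H h × a ≡ ⟦ c ℤ.+ rep h ⟧)
infixr 6 _+S_

±_+S_ : ∀ {ℓ} .{{_ : ℕ.NonZero ℓ}} → ℤ → Sub ℓ → Sub ℓ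
(± c +S H) = (c +S H) ∪ ((ℤ.- c) +S H)

⟨_⟩ : ∀ {ℓ} .{{_ : ℕ.NonZero ℓ}} → ℤ → Sub ℓ
⟨ h ⟩ a = ∃[ n ] (a ≡ ⟦ n ℤ.* h ⟧)

⟨_⟩* : ∀ {ℓ} .{{_ : ℕ.NonZero ℓ}} → ℤ → Sub ℓ
⟨ h ⟩* a = ⟨ h ⟩ a × a ≢ ⟦ + 0 ⟧

Nx : ℕ → ℕ
Nx k = 4 ℕ.+ 8 ℕ.* k

Ny : ℕ → ℕ
Ny k = 2 ℕ.+ 4 ℕ.* k

data V (k : ℕ) : Set where
  x : Fin (Nx k) → V k
  y : Fin (Ny k) → V k

data InM (k : ℕ) : ℤ → Set where
  m0 : InM k (+ 0)
  m1 : InM k (+ (2 ℕ.* k) ℤ.- + 1)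
  m2 : InM k (+ (2 ℕ.* k ℕ.+ 1))
  m3 : InM k (+ (4 ℕ.* k ℕ.+ 2))
  m4 : InM k (+ (6 ℕ.* k ℕ.+ 1))
  m5 : InM k (+ (6 ℕ.* k ℕ.+ 3))

YX : (k : ℕ) → Fin (Ny k) → Fin (Nx k) → Set
YX k b a = ∃[ m ] (InM k m × a ≡ ⟦ rep b ℤ.+ m ⟧)

data Adj (k : ℕ) : V k → V k → Set where
  xx⁺ : ∀ {a b} → b ≡ ⟦ rep a ℤ.+ + 1 ⟧ → Adj k (x a) (x b)
  xx⁻ : ∀ {a b} → a ≡ ⟦ rep b ℤ.+ + 1 ⟧ → Adj k (x a) (x b)
  yx  : ∀ {b a} → YX k b a → Adj k (y b) (x a)
  xy  : ∀ {a b} → YX k b a → Adj k (x a) (y b)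

data Walk (k : ℕ) : V k → V k → ℕ → Set where
  here : ∀ {u} → Walk k u u zero
  step : ∀ {u v w n} → Adj k u v → Walk k v w n → Walk k u w (suc n)

Dist : (k : ℕ) → V k → V k → ℕ → Set
Dist k u v d = Walk k u v d × (∀ m → m < d → ¬ Walk k u v m)

SphereIs : (k : ℕ) → V k → ℕ → Sub (Nx k) → Sub (Ny k) → Set
SphereIs k u i A B =
  (∀ a → (Dist k u (x a) i ⇔ A a)) × (∀ b → (Dist k u (y b) i ⇔ B b))

HasSize : (k : ℕ) → (V k → Set) → ℕ → Set
HasSize k P n =
  Σ (List (V k)) λ vs → Unique vs × length vs ≡ n × (∀ v → (v ∈ vs ⇔ P v))

SphereSize : (k : ℕ) → V k → ℕ → ℕ → Set
SphereSize k u i n = HasSize k (λ v → Dist k u v i) n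

Ecc : (k : ℕ) → V k → ℕ → Set
Ecc k u e = (∀ v → ∃[ d ] (d ≤ e × Dist k u v d)) × (∃[ v ] Dist k u v e)

-- Give x_a the level a and y_b the level b - 1, and let G = 2k + 1. Modulo G the set M is
-- {0, -2}, so every edge changes the level by ±1 modulo G. Hence a walk of length m from x_j only
-- reaches vertices whose level is j ± s modulo G with s ≤ m, and s ≡ m (mod 2) when m + s < G.
-- Conversely, running along the x-cycle and finishing with a two-step jump x_a → y → x_c
-- (available whenever c ≡ a or a ± 2 modulo G) attains this bound, so a vertex at offset ±s,
-- s ≤ k, lies at distance s, except for a few vertices close to x_j that are treated by hand.
-- Each sphere is thus a union of (punctured) cosets of ⟨G⟩, counted by listing their elements.

module Submission where

open import Defs
open import Data.Nat as N using (ℕ; _≤_)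
open import Data.Integer using (ℤ; +_; _+_; _*_)
open import Data.Fin using (Fin)
open import Data.Product using (_×_)

open N using (zero; suc; _<_; z≤n; s≤s)
import Data.Nat.Properties as NP
import Data.Nat.Divisibility as ND
import Data.Nat.Tactic.RingSolver as NS
open import Data.Integer as Z using (_-_; -_; 0ℤ)
import Data.Integer.Properties as ZP
open import Data.Nat.DivMod using (m<n⇒m%n≡m)
open import Data.Integer.DivMod using (_%ℕ_; _/ℕ_; n%ℕd<d; a≡a%ℕn+[a/ℕn]*n)
open import Data.Integer.Divisibility.Signed
  using (_∣_; divides; ∣⇒∣ᵤ; ∣m∣n⇒∣m+n; ∣m∣n⇒∣m-n; ∣m⇒∣-m; ∣-trans; *-cancelʳ-∣)
open import Data.Integer.Tactic.RingSolver using (solve-∀)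
open import Data.Fin as F using (fromℕ<; toℕ)
import Data.Fin.Properties as FP
open import Data.Product using (∃; ∃-syntax; _,_; proj₁)
open import Data.Sum using (_⊎_; inj₁; inj₂)
open import Data.List using (List; _∷_; [_]; _++_; map; drop; length; allFin)
open import Data.List.Membership.Propositional using (_∈_)
open import Data.List.Membership.Propositional.Properties
  using (∈-map⁺; ∈-map⁻; ∈-allFin; ∈-++⁺ˡ; ∈-++⁺ʳ; ∈-++⁻)
open import Data.List.Relation.Unary.Any using (here; there)
import Data.List.Relation.Unary.All as All
open import Data.List.Relation.Unary.AllPairs using ([]; _∷_)
open import Data.List.Relation.Unary.Unique.Propositional using (Unique)
import Data.List.Relation.Unary.Unique.Propositional.Properties as Unique
open import Data.List.Properties using (length-++; length-map)
open import Relation.Nullary using (¬_; yes; no; contradiction)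
open import Relation.Binary.Definitions using (tri<; tri≈; tri>)
open import Relation.Binary.PropositionalEquality hiding ([_]; J)
open import Function.Base using (_∘_)
open import Function.Bundles using (_⇔_; mk⇔; Equivalence)
open Equivalence using (to; from)
open import Data.Sum.Function.Propositional using (_⊎-⇔_)
open import Data.Product.Function.NonDependent.Propositional using (_×-⇔_)
import Function.Properties.Equivalence as ⇔

-- Divisibility and reduction modulo ℓ

∣i∣<n∧n∣i⇒i≡0 : ∀ {n i} → Z.∣ i ∣ < n → + n ∣ i → i ≡ 0ℤ
∣i∣<n∧n∣i⇒i≡0 {n} {i} lt n∣i with Z.∣ i ∣ in eq
... | zero  = ZP.∣i∣≡0⇒i≡0 eq
... | suc _ = contradiction (subst (n ND.∣_) eq (∣⇒∣ᵤ n∣i)) (ND.>⇒∤ lt)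

∣⇒∣-offset : ∀ t .{{_ : N.NonZero t}} {n w} → n ∣ w →
             ∃[ q ] (q < t × + t * n ∣ w - + q * n)
∣⇒∣-offset t {n} (divides c refl) =
  c %ℕ t , n%ℕd<d c t , divides (c /ℕ t) (begin
    c * n - r * n                 ≡⟨ cong (λ u → u * n - r * n) (a≡a%ℕn+[a/ℕn]*n c t) ⟩
    (r + c /ℕ t * + t) * n - r * n ≡⟨ shift r (c /ℕ t) (+ t) n ⟩
    c /ℕ t * (+ t * n)             ∎)
  where
  open ≡-Reasoning
  r = + (c %ℕ t)
  shift : ∀ r q t n → (r + q * t) * n - r * n ≡ q * (t * n)
  shift = solve-∀

∣m-n∣<o : ∀ {m n o} → m < o → n < o → Z.∣ + m - + n ∣ < o
∣m-n∣<o {m} {n} m<o n<o = NP.≤-<-trans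
  (subst (λ i → Z.∣ i ∣ ≤ m N.⊔ n) (sym (ZP.m-n≡m⊖n m n)) (ZP.∣m⊝n∣≤m⊔n m n))
  (NP.⊔-lub m<o n<o)

∣-resp-≡ : ∀ {d w w'} → w ≡ w' → (d ∣ w) ⇔ (d ∣ w')
∣-resp-≡ refl = ⇔.refl

∣-resp-∣- : ∀ {d w w'} → d ∣ w - w' → (d ∣ w) ⇔ (d ∣ w')
∣-resp-∣- {d} {w} {w'} d∣w-w' = mk⇔
  (λ d∣w → subst (d ∣_) (cancelˡ w w') (∣m∣n⇒∣m-n d∣w d∣w-w'))
  (λ d∣w' → subst (d ∣_) (cancelʳ w w') (∣m∣n⇒∣m+n d∣w-w' d∣w'))
  where
  cancelˡ : ∀ w w' → w - (w - w') ≡ w'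
  cancelˡ = solve-∀
  cancelʳ : ∀ w w' → (w - w') + w' ≡ w
  cancelʳ = solve-∀

o∣m-n⇒m≡n : ∀ {m n o} → m < o → n < o → + o ∣ + m - + n → m ≡ n
o∣m-n⇒m≡n {m} {n} m<o n<o o∣m-n =
  ZP.+-injective (ZP.i-j≡0⇒i≡j (+ m) (+ n) (∣i∣<n∧n∣i⇒i≡0 (∣m-n∣<o m<o n<o) o∣m-n))

module _ {ℓ : ℕ} .{{_ : N.NonZero ℓ}} where

  rep-⟦⟧ : ∀ z → rep (⟦_⟧ {ℓ} z) ≡ + (z %ℕ ℓ)
  rep-⟦⟧ z = cong +_ (FP.toℕ-fromℕ< (n%ℕd<d z ℓ))

  ∣rep⟦z⟧-z : ∀ z → + ℓ ∣ rep (⟦_⟧ {ℓ} z) - z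
  ∣rep⟦z⟧-z z = divides (- (z /ℕ ℓ)) (begin
    rep (⟦_⟧ {ℓ} z) - z                        ≡⟨ cong₂ _-_ (rep-⟦⟧ z) (a≡a%ℕn+[a/ℕn]*n z ℓ) ⟩
    + (z %ℕ ℓ) - (+ (z %ℕ ℓ) + z /ℕ ℓ * + ℓ)   ≡⟨ cancel (+ (z %ℕ ℓ)) (z /ℕ ℓ) (+ ℓ) ⟩
    - (z /ℕ ℓ) * + ℓ                           ∎)
    where
    open ≡-Reasoning
    cancel : ∀ r q l → r - (r + q * l) ≡ - q * l
    cancel = solve-∀

  ⟦rep⟧ : (a : Fin ℓ) → ⟦ rep a ⟧ ≡ a
  ⟦rep⟧ a = FP.toℕ-injective
    (trans (FP.toℕ-fromℕ< (n%ℕd<d (rep a) ℓ)) (m<n⇒m%n≡m (FP.toℕ<n a)))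

  ∣⇒⟦⟧≡ : ∀ {z z'} → + ℓ ∣ z - z' → ⟦_⟧ {ℓ} z ≡ ⟦ z' ⟧
  ∣⇒⟦⟧≡ {z} {z'} ℓ∣z-z' = FP.toℕ-injective (begin
    toℕ (⟦_⟧ {ℓ} z)  ≡⟨ FP.toℕ-fromℕ< (n%ℕd<d z ℓ) ⟩
    z %ℕ ℓ           ≡⟨ o∣m-n⇒m≡n (n%ℕd<d z ℓ) (n%ℕd<d z' ℓ) ℓ∣r-r' ⟩
    z' %ℕ ℓ          ≡⟨ FP.toℕ-fromℕ< (n%ℕd<d z' ℓ) ⟨
    toℕ (⟦_⟧ {ℓ} z') ∎)
    where
    open ≡-Reasoning
    telescope : ∀ r z z' r' → (r - z) + (z - z') - (r' - z') ≡ r - r'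
    telescope = solve-∀
    ℓ∣r-r' : + ℓ ∣ + (z %ℕ ℓ) - + (z' %ℕ ℓ)
    ℓ∣r-r' = subst (+ ℓ ∣_)
      (trans (telescope (rep (⟦_⟧ {ℓ} z)) z z' (rep (⟦_⟧ {ℓ} z'))) (cong₂ _-_ (rep-⟦⟧ z) (rep-⟦⟧ z')))
      (∣m∣n⇒∣m-n (∣m∣n⇒∣m+n (∣rep⟦z⟧-z z) ℓ∣z-z') (∣rep⟦z⟧-z z'))

  ≡⟦⟧⇒∣ : ∀ {a : Fin ℓ} z → a ≡ ⟦ z ⟧ → + ℓ ∣ rep a - z
  ≡⟦⟧⇒∣ z refl = ∣rep⟦z⟧-z z

  ∣⇒≡⟦⟧ : ∀ {a : Fin ℓ} z → + ℓ ∣ rep a - z → a ≡ ⟦ z ⟧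
  ∣⇒≡⟦⟧ {a} z ℓ∣a-z = trans (sym (⟦rep⟧ a)) (∣⇒⟦⟧≡ {rep a} {z} ℓ∣a-z)

  ⟦⟧≡⇒∣ : ∀ {z z'} → ⟦_⟧ {ℓ} z ≡ ⟦ z' ⟧ → + ℓ ∣ z - z'
  ⟦⟧≡⇒∣ {z} {z'} eq = subst (+ ℓ ∣_) (cancel (rep (⟦_⟧ {ℓ} z)) z z')
    (∣m∣n⇒∣m-n (≡⟦⟧⇒∣ z' eq) (∣rep⟦z⟧-z z))
    where
    cancel : ∀ r z z' → (r - z') - (r - z) ≡ z - z'
    cancel = solve-∀

  ≡⟦⟧⇔∣ : ∀ {a : Fin ℓ} z → a ≡ ⟦ z ⟧ ⇔ (+ ℓ ∣ rep a - z)
  ≡⟦⟧⇔∣ z = mk⇔ (≡⟦⟧⇒∣ z) (∣⇒≡⟦⟧ z)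

  ⟦⟧≡⟦⟧⇔∣ : ∀ z z' → ⟦_⟧ {ℓ} z ≡ ⟦ z' ⟧ ⇔ (+ ℓ ∣ z - z')
  ⟦⟧≡⟦⟧⇔∣ z z' = mk⇔ (⟦⟧≡⇒∣ {z} {z'}) (∣⇒⟦⟧≡ {z} {z'})

  +S-⇔ : ∀ {H : Sub ℓ} c a → (c +S H) a ⇔ H ⟦ rep a - c ⟧
  +S-⇔ {H} c a = mk⇔
    (λ { (h , Hh , a≡c+h) → subst H (∣⇒≡⟦⟧ (rep a - c)
           (subst (+ ℓ ∣_) (flip (rep a) c (rep h)) (∣m⇒∣-m (≡⟦⟧⇒∣ (c + rep h) a≡c+h)))) Hh })
    (λ Hh → ⟦ rep a - c ⟧ , Hh , ∣⇒≡⟦⟧ (c + rep ⟦ rep a - c ⟧)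
           (subst (+ ℓ ∣_) (unflip (rep a) c (rep ⟦ rep a - c ⟧)) (∣m⇒∣-m (∣rep⟦z⟧-z (rep a - c)))))
    where
    flip : ∀ a c h → - (a - (c + h)) ≡ h - (a - c)
    flip = solve-∀
    unflip : ∀ a c h → - (h - (a - c)) ≡ a - (c + h)
    unflip = solve-∀

  +S-∪ : ∀ {H H' : Sub ℓ} c a → (c +S (H ∪ H')) a ⇔ ((c +S H) ∪ (c +S H')) a
  +S-∪ c a = ⇔.trans (+S-⇔ c a) (⇔.sym (+S-⇔ c a ⊎-⇔ +S-⇔ c a))

  +S-assoc : ∀ {H : Sub ℓ} c d a → (c +S (d +S H)) a ⇔ ((c + d) +S H) a
  +S-assoc {H} c d a = ⇔.trans (+S-⇔ c a) (⇔.trans (+S-⇔ d ⟦ rep a - c ⟧) (⇔.trans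
    (mk⇔ (subst H same) (subst H (sym same))) (⇔.sym (+S-⇔ (c + d) a))))
    where
    identity : ∀ r a c d → (r - d) - (a - (c + d)) ≡ r - (a - c)
    identity = solve-∀
    same : ⟦ rep ⟦ rep a - c ⟧ - d ⟧ ≡ ⟦ rep a - (c + d) ⟧
    same = ∣⇒⟦⟧≡ {rep (⟦_⟧ {ℓ} (rep a - c)) - d} {rep a - (c + d)}
      (subst (+ ℓ ∣_) (sym (identity (rep (⟦_⟧ {ℓ} (rep a - c))) (rep a) c d)) (∣rep⟦z⟧-z (rep a - c)))

  +S-｛｝ : ∀ c e a → (c +S ｛ e ｝) a ⇔ a ≡ ⟦ c + e ⟧
  +S-｛｝ c e a = ⇔.trans (+S-⇔ c a) (⇔.trans (⟦⟧≡⟦⟧⇔∣ (rep a - c) e)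
    (⇔.trans (∣-resp-≡ (assoc (rep a) c e)) (⇔.sym (≡⟦⟧⇔∣ (c + e)))))
    where
    assoc : ∀ a c e → a - c - e ≡ a - (c + e)
    assoc = solve-∀

-- Cosets of ⟨ G ⟩ in ℤ_ℓ

module Cosets {ℓ : ℕ} .{{_ : N.NonZero ℓ}} (G : ℤ) (G∣ℓ : G ∣ + ℓ) where

  IsCoset : Sub ℓ → ℤ → Set
  IsCoset H d = ∀ a → H a ⇔ (G ∣ rep a - d)

  IsPuncturedCoset : Sub ℓ → ℤ → Set
  IsPuncturedCoset H d = ∀ a → H a ⇔ (G ∣ rep a - d × a ≢ ⟦ d ⟧)

  G∣rep⟦z⟧-z : ∀ z → G ∣ rep (⟦_⟧ {ℓ} z) - z
  G∣rep⟦z⟧-z z = ∣-trans G∣ℓ (∣rep⟦z⟧-z z)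

  ⟨⟩-isCoset : IsCoset ⟨ G ⟩ 0ℤ
  ⟨⟩-isCoset a = mk⇔
    (λ { (n , a≡nG) → subst (G ∣_) (shift (rep a) (n * G))
           (∣m∣n⇒∣m+n (∣-trans G∣ℓ (≡⟦⟧⇒∣ (n * G) a≡nG)) (divides n refl)) })
    (λ { (divides n eq) → n , ∣⇒≡⟦⟧ (n * G) (subst (+ ℓ ∣_) (sym (unshift (rep a) (n * G) eq)) zero∣) })
    where
    shift : ∀ a m → (a - m) + m ≡ a - 0ℤ
    shift = solve-∀
    unshift : ∀ a m → a - 0ℤ ≡ m → a - m ≡ 0ℤ
    unshift a m eq = trans (cong (_- m) (trans (sym (ZP.+-identityʳ a)) eq)) (ZP.+-inverseʳ m)
    zero∣ : + ℓ ∣ 0ℤ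
    zero∣ = divides 0ℤ refl

  ⟨⟩*-isPuncturedCoset : IsPuncturedCoset ⟨ G ⟩* 0ℤ
  ⟨⟩*-isPuncturedCoset a = mk⇔
    (λ { (a∈⟨G⟩ , a≢0) → to (⟨⟩-isCoset a) a∈⟨G⟩ , a≢0 })
    (λ { (G∣a , a≢0) → from (⟨⟩-isCoset a) G∣a , a≢0 })

  +S-translate : ∀ (a : Fin ℓ) c d → (G ∣ rep (⟦_⟧ {ℓ} (rep a - c)) - d) ⇔ (G ∣ rep a - (c + d))
  +S-translate a c d = ∣-resp-∣- (subst (G ∣_) (telescope (rep ⟦ rep a - c ⟧) (rep a) c d)
    (G∣rep⟦z⟧-z (rep a - c)))
    where
    telescope : ∀ r a c d → r - (a - c) ≡ (r - d) - (a - (c + d))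
    telescope = solve-∀

  +S-isCoset : ∀ {H d} c → IsCoset H d → IsCoset (c +S H) (c + d)
  +S-isCoset {H} {d} c H≡ a =
    ⇔.trans (+S-⇔ c a) (⇔.trans (H≡ ⟦ rep a - c ⟧) (+S-translate a c d))

  +S-isPuncturedCoset : ∀ {H d} c → IsPuncturedCoset H d → IsPuncturedCoset (c +S H) (c + d)
  +S-isPuncturedCoset {H} {d} c H≡ a =
    ⇔.trans (+S-⇔ c a) (⇔.trans (H≡ ⟦ rep a - c ⟧) (mk⇔
      (λ { (G∣ , ≢d) → to (+S-translate a c d) G∣ , λ a≡ → ≢d (from shifted a≡) })
      (λ { (G∣ , ≢c+d) → from (+S-translate a c d) G∣ , λ ≡d → ≢c+d (to shifted ≡d) })))
    where
    assoc : ∀ a c d → a - c - d ≡ a - (c + d)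
    assoc = solve-∀
    shifted : ⟦ rep a - c ⟧ ≡ ⟦ d ⟧ ⇔ a ≡ ⟦ c + d ⟧
    shifted = ⇔.trans (⟦⟧≡⟦⟧⇔∣ (rep a - c) d)
      (⇔.trans (∣-resp-≡ (assoc (rep a) c d)) (⇔.sym (≡⟦⟧⇔∣ (c + d))))


-- Enumerations by duplicate-free lists

∈-tail⇔ : ∀ {A : Set} {v : A} {vs a} → Unique (v ∷ vs) → a ∈ vs ⇔ (a ∈ v ∷ vs × a ≢ v)
∈-tail⇔ (v∉vs ∷ _) = mk⇔
  (λ a∈vs → there a∈vs , λ { refl → All.lookup v∉vs a∈vs refl })
  (λ { (here a≡v , a≢v) → contradiction a≡v a≢v ; (there a∈vs , _) → a∈vs })

Enumerates : ∀ {ℓ} → List (Fin ℓ) → Sub ℓ → Set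
Enumerates xs P = Unique xs × (∀ a → a ∈ xs ⇔ P a)

module _ {ℓ : ℕ} where

  Enumerates-resp : ∀ {xs} {P Q : Sub ℓ} → (∀ a → P a ⇔ Q a) → Enumerates xs P → Enumerates xs Q
  Enumerates-resp P⇔Q (xs! , ∈xs⇔P) = xs! , λ a → ⇔.trans (∈xs⇔P a) (P⇔Q a)

  Enumerates-∪ : ∀ {xs ys} {P Q : Sub ℓ} → Enumerates xs P → Enumerates ys Q →
                 (∀ a → P a → ¬ Q a) → Enumerates (xs ++ ys) (P ∪ Q)
  Enumerates-∪ {xs} (xs! , ∈xs⇔P) (ys! , ∈ys⇔Q) P∩Q=∅ =
    Unique.++⁺ xs! ys! (λ { {a} (a∈xs , a∈ys) →
      P∩Q=∅ a (to (∈xs⇔P a) a∈xs) (to (∈ys⇔Q a) a∈ys) }) ,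
    λ a → mk⇔
      (λ a∈ → Data.Sum.map (to (∈xs⇔P a)) (to (∈ys⇔Q a)) (∈-++⁻ xs a∈))
      (Data.Sum.[ (λ Pa → ∈-++⁺ˡ (from (∈xs⇔P a) Pa))
                , (λ Qa → ∈-++⁺ʳ xs (from (∈ys⇔Q a) Qa)) ])

  Enumerates-｛｝ : .{{_ : N.NonZero ℓ}} → ∀ c → Enumerates [ ⟦_⟧ {ℓ} c ] ｛ c ｝
  Enumerates-｛｝ c = (All.[] ∷ []) ,
    λ a → mk⇔ (λ { (here a≡) → a≡ }) here


module CosetLists {ℓ : ℕ} .{{_ : N.NonZero ℓ}} (t : ℕ) (G : ℤ) .{{_ : Z.NonZero G}}
                  (ℓ≡ : + ℓ ≡ + suc t * G) where

  G∣ℓ : G ∣ + ℓ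
  G∣ℓ = divides (+ suc t) ℓ≡

  open Cosets G G∣ℓ

  cosetList : ℤ → List (Fin ℓ)
  cosetList d = map (λ q → ⟦ d + + toℕ q * G ⟧) (allFin (suc t))

  ∈-cosetList : ∀ d a → a ∈ cosetList d ⇔ (G ∣ rep a - d)
  ∈-cosetList d a = mk⇔ member nonmember
    where
    unshift : ∀ a d m → (a - (d + m)) + m ≡ a - d
    unshift = solve-∀
    assoc : ∀ a d m → a - d - m ≡ a - (d + m)
    assoc = solve-∀
    member : a ∈ cosetList d → G ∣ rep a - d
    member a∈ with ∈-map⁻ (λ i → ⟦ d + + toℕ i * G ⟧) {xs = allFin (suc t)} a∈
    ... | q , _ , a≡ = subst (G ∣_) (unshift (rep a) d (+ toℕ q * G))
      (∣m∣n⇒∣m+n (∣-trans G∣ℓ (≡⟦⟧⇒∣ (d + + toℕ q * G) a≡)) (divides (+ toℕ q) refl))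
    nonmember : G ∣ rep a - d → a ∈ cosetList d
    nonmember G∣a-d with ∣⇒∣-offset (suc t) G∣a-d
    ... | q , q<t , tG∣ =
      subst (_∈ cosetList d) (sym a≡) (∈-map⁺ (λ i → ⟦ d + + toℕ i * G ⟧) (∈-allFin (fromℕ< q<t)))
      where
      a≡ : a ≡ ⟦ d + + toℕ (fromℕ< q<t) * G ⟧
      a≡ = ∣⇒≡⟦⟧ (d + + toℕ (fromℕ< q<t) * G) (subst₂ _∣_ (sym ℓ≡)
        (trans (assoc (rep a) d (+ q * G)) (cong (λ i → rep a - (d + + i * G)) (sym (FP.toℕ-fromℕ< q<t))))
        tG∣)

  cosetList-unique : ∀ d → Unique (cosetList d)
  cosetList-unique d = Unique.map⁺ injective (Unique.allFin⁺ (suc t))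
    where
    difference : ∀ d q q' G → (d + q * G) - (d + q' * G) ≡ (q - q') * G
    difference = solve-∀
    injective : ∀ {q q'} → ⟦_⟧ {ℓ} (d + + toℕ q * G) ≡ ⟦ d + + toℕ q' * G ⟧ → q ≡ q'
    injective {q} {q'} eq = FP.toℕ-injective (o∣m-n⇒m≡n (FP.toℕ<n q) (FP.toℕ<n q')
      (*-cancelʳ-∣ G (subst₂ _∣_ ℓ≡ (difference d (+ toℕ q) (+ toℕ q') G)
        (⟦⟧≡⇒∣ {ℓ} {d + + toℕ q * G} {d + + toℕ q' * G} eq))))

  cosetList-enumerates : ∀ {H d} → IsCoset H d → Enumerates (cosetList d) H
  cosetList-enumerates {H} {d} H≡ = cosetList-unique d , λ a → ⇔.trans (∈-cosetList d a) (⇔.sym (H≡ a))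

  puncturedCosetList : ℤ → List (Fin ℓ)
  puncturedCosetList d = drop 1 (cosetList d)

  puncturedCosetList-enumerates : ∀ {H d} → IsPuncturedCoset H d →
                                  Enumerates (puncturedCosetList d) H
  puncturedCosetList-enumerates {H} {d} H≡ =
    Unique.drop⁺ 1 (cosetList-unique d) ,
    λ a → ⇔.trans (∈-tail⇔ (cosetList-unique d))
      (⇔.trans (mk⇔ (λ { (a∈ , a≢) → to (∈-cosetList d a) a∈ , λ a≡ → a≢ (trans a≡ d≡) })
                    (λ { (G∣ , a≢) → from (∈-cosetList d a) G∣ , λ a≡ → a≢ (trans a≡ (sym d≡)) }))
               (⇔.sym (H≡ a)))
    where
    d≡ : ⟦_⟧ {ℓ} d ≡ ⟦ d + + 0 * G ⟧
    d≡ = cong ⟦_⟧ (sym (trans (cong (λ m → d + m) (ZP.*-zeroˡ G)) (ZP.+-identityʳ d)))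


module _ {k : ℕ} where

  infixr 5 _++ʷ_
  _++ʷ_ : ∀ {u v w m n} → Walk k u v m → Walk k v w n → Walk k u w (m N.+ n)
  here ++ʷ walk = walk
  step e walk ++ʷ walk′ = step e (walk ++ʷ walk′)

  Dist-unique : ∀ {u v d d'} → Dist k u v d → Dist k u v d' → d ≡ d'
  Dist-unique {d = d} {d'} (walk , shortest) (walk′ , shortest′) with NP.<-cmp d d'
  ... | tri< d<d' _ _ = contradiction walk (shortest′ d d<d')
  ... | tri≈ _ d≡d' _ = d≡d'
  ... | tri> _ _ d'<d = contradiction walk′ (shortest d' d'<d)

  Walk-shortest : ∀ {u v d} → Walk k u v d → (∀ {m} → Walk k u v m → d ≤ m) → Dist k u v d
  Walk-shortest walk minimal = walk , λ m m<d walk′ → NP.<⇒≱ m<d (minimal walk′)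

  SphereIs⇒SphereSize : ∀ {u i A B xs ys} → SphereIs k u i A B → Enumerates xs A → Enumerates ys B →
                        SphereSize k u i (length xs N.+ length ys)
  SphereIs⇒SphereSize {xs = xs} {ys} (x-sphere , y-sphere) (xs! , ∈xs⇔A) (ys! , ∈ys⇔B) =
    map (x {k}) xs ++ map (y {k}) ys ,
    Unique.++⁺ (Unique.map⁺ x-injective xs!) (Unique.map⁺ y-injective ys!) x≢y ,
    trans (length-++ (map (x {k}) xs)) (cong₂ N._+_ (length-map (x {k}) xs) (length-map (y {k}) ys)) ,
    λ { (x a) → ⇔.trans (∈x⇔ a) (⇔.trans (∈xs⇔A a) (⇔.sym (x-sphere a)))
      ; (y b) → ⇔.trans (∈y⇔ b) (⇔.trans (∈ys⇔B b) (⇔.sym (y-sphere b))) }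
    where
    x-injective : ∀ {a a'} → x {k} a ≡ x a' → a ≡ a'
    x-injective refl = refl
    y-injective : ∀ {b b'} → y {k} b ≡ y b' → b ≡ b'
    y-injective refl = refl
    x≢y : ∀ {v} → ¬ (v ∈ map (x {k}) xs × v ∈ map (y {k}) ys)
    x≢y (v∈xs , v∈ys) with ∈-map⁻ (x {k}) v∈xs | ∈-map⁻ (y {k}) v∈ys
    ... | _ , _ , refl | _ , _ , ()
    ∈x⇔ : ∀ a → x {k} a ∈ map (x {k}) xs ++ map (y {k}) ys ⇔ a ∈ xs
    ∈x⇔ a = mk⇔ from-list (λ a∈xs → ∈-++⁺ˡ (∈-map⁺ (x {k}) a∈xs))
      where
      from-list : x {k} a ∈ map (x {k}) xs ++ map (y {k}) ys → a ∈ xs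
      from-list a∈ with ∈-++⁻ (map (x {k}) xs) a∈
      ... | inj₁ a∈xs with ∈-map⁻ (x {k}) a∈xs
      ...   | _ , a∈′ , refl = a∈′
      from-list a∈ | inj₂ a∈ys with ∈-map⁻ (y {k}) a∈ys
      ...   | _ , _ , ()
    ∈y⇔ : ∀ b → y {k} b ∈ map (x {k}) xs ++ map (y {k}) ys ⇔ b ∈ ys
    ∈y⇔ b = mk⇔ from-list (λ b∈ys → ∈-++⁺ʳ (map (x {k}) xs) (∈-map⁺ (y {k}) b∈ys))
      where
      from-list : y {k} b ∈ map (x {k}) xs ++ map (y {k}) ys → b ∈ ys
      from-list b∈ with ∈-++⁻ (map (x {k}) xs) b∈
      ... | inj₂ b∈ys with ∈-map⁻ (y {k}) b∈ys
      ...   | _ , b∈′ , refl = b∈′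
      from-list b∈ | inj₁ b∈xs with ∈-map⁻ (x {k}) b∈xs
      ...   | _ , _ , ()

-- Levels in Γ^(k)

module Γ (k : ℕ) (k≥5 : 5 ≤ k) where

  k≥1 : 1 ≤ k
  k≥1 = NP.≤-trans (s≤s z≤n) k≥5

  k≥2 : 2 ≤ k
  k≥2 = NP.≤-trans (s≤s (s≤s z≤n)) k≥5

  k≥3 : 3 ≤ k
  k≥3 = NP.≤-trans (s≤s (s≤s (s≤s z≤n))) k≥5

  k≥4 : 4 ≤ k
  k≥4 = NP.≤-trans (s≤s (s≤s (s≤s (s≤s z≤n)))) k≥5

  g : ℕ
  g = 2 N.* k N.+ 1

  G : ℤ
  G = + g

  g≡k+k+1 : g ≡ suc (k N.+ k)
  g≡k+k+1 = identity k
    where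
    identity : ∀ k → 2 N.* k N.+ 1 ≡ suc (k N.+ k)
    identity = NS.solve-∀

  instance
    g-nonZero : N.NonZero g
    g-nonZero = subst N.NonZero (sym g≡k+k+1) _

  s+t<g : ∀ {s t} → s ≤ k → t ≤ k → s N.+ t < g
  s+t<g {s} {t} s≤k t≤k = subst (s N.+ t <_) (sym g≡k+k+1) (s≤s (NP.+-mono-≤ s≤k t≤k))

  k<g : k < g
  k<g = NP.≤-<-trans (NP.m≤m+n k 0) (s+t<g NP.≤-refl z≤n)

  ≤8⇒<g : ∀ {n} → n ≤ 8 → n < g
  ≤8⇒<g n≤8 = NP.≤-<-trans n≤8 (s+t<g {4} {4} k≥4 k≥4)

  ¬G∣ : ∀ {w} → w ≢ 0ℤ → Z.∣ w ∣ < g → ¬ G ∣ w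
  ¬G∣ w≢0 ∣w∣<g G∣w = w≢0 (∣i∣<n∧n∣i⇒i≡0 ∣w∣<g G∣w)

  kℤ : ℤ
  kℤ = + k

  +[ak+b] : ∀ a b → + (a N.* k N.+ b) ≡ + a * kℤ + + b
  +[ak+b] a b = cong (_+ + b) (ZP.pos-* a k)

  G≡2k+1 : G ≡ + 2 * kℤ + + 1
  G≡2k+1 = +[ak+b] 2 1

  Ny≡4k+2 : + Ny k ≡ + 4 * kℤ + + 2
  Ny≡4k+2 = trans (ZP.+-comm (+ 2) (+ (4 N.* k))) (+[ak+b] 4 2)

  Ny≡2G : + Ny k ≡ + 2 * G
  Ny≡2G = trans Ny≡4k+2 (trans (identity kℤ) (cong (+ 2 *_) (sym G≡2k+1)))
    where
    identity : ∀ K → + 4 * K + + 2 ≡ + 2 * (+ 2 * K + + 1)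
    identity = solve-∀

  Nx≡2Ny : + Nx k ≡ + 2 * + Ny k
  Nx≡2Ny = cong +_ (identity k)
    where
    identity : ∀ k → 4 N.+ 8 N.* k ≡ 2 N.* (2 N.+ 4 N.* k)
    identity = NS.solve-∀

  Nx≡4G : + Nx k ≡ + 4 * G
  Nx≡4G = trans Nx≡2Ny (trans (cong (+ 2 *_) Ny≡2G) (sym (ZP.*-assoc (+ 2) (+ 2) G)))

  Nx∣⇒Ny∣ : ∀ {w} → + Nx k ∣ w → + Ny k ∣ w
  Nx∣⇒Ny∣ = ∣-trans (divides (+ 2) Nx≡2Ny)

  Ny∣⇒G∣ : ∀ {w} → + Ny k ∣ w → G ∣ w
  Ny∣⇒G∣ = ∣-trans (divides (+ 2) Ny≡2G)

  Nx∣⇒G∣ : ∀ {w} → + Nx k ∣ w → G ∣ w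
  Nx∣⇒G∣ Nx∣w = Ny∣⇒G∣ (Nx∣⇒Ny∣ Nx∣w)

  in-kℤ : ∀ {m} (f : ℤ → ℤ → ℤ) → m ≡ f (+ 2 * kℤ + + 1) (+ 4 * kℤ + + 2) → m ≡ f G (+ Ny k)
  in-kℤ f eq = trans eq (cong₂ f (sym G≡2k+1) (sym Ny≡4k+2))

  m0≡ : 0ℤ ≡ + 0 * G
  m0≡ = sym (ZP.*-zeroˡ G)

  m1≡ : + (2 N.* k) - + 1 ≡ (G - + 2) + + 0 * + Ny k
  m1≡ = in-kℤ (λ G N → (G - + 2) + + 0 * N) (trans (cong (_- + 1) (ZP.pos-* 2 k)) (identity kℤ))
    where
    identity : ∀ k → + 2 * k - + 1 ≡ ((+ 2 * k + + 1) - + 2) + + 0 * (+ 4 * k + + 2)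
    identity = solve-∀

  m2≡ : + (2 N.* k N.+ 1) ≡ + 1 * G
  m2≡ = sym (ZP.*-identityˡ G)

  m3≡ : + (4 N.* k N.+ 2) ≡ + 2 * G
  m3≡ = in-kℤ (λ G _ → + 2 * G) (trans (+[ak+b] 4 2) (identity kℤ))
    where
    identity : ∀ k → + 4 * k + + 2 ≡ + 2 * (+ 2 * k + + 1)
    identity = solve-∀

  m4≡ : + (6 N.* k N.+ 1) ≡ (G - + 2) + + 1 * + Ny k
  m4≡ = in-kℤ (λ G N → (G - + 2) + + 1 * N) (trans (+[ak+b] 6 1) (identity kℤ))
    where
    identity : ∀ k → + 6 * k + + 1 ≡ ((+ 2 * k + + 1) - + 2) + + 1 * (+ 4 * k + + 2)
    identity = solve-∀

  m5≡ : + (6 N.* k N.+ 3) ≡ + 3 * G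
  m5≡ = in-kℤ (λ G _ → + 3 * G) (trans (+[ak+b] 6 3) (identity kℤ))
    where
    identity : ∀ k → + 6 * k + + 3 ≡ + 3 * (+ 2 * k + + 1)
    identity = solve-∀

  -- M = {0, G, 2G, 3G} ∪ {G - 2, G - 2 + Ny k}, so y_b ~ x_a depends on a - b modulo G and Ny k only
  YX⇒ : ∀ {b a} → YX k b a → G ∣ rep a - rep b ⊎ + Ny k ∣ rep a - rep b - (G - + 2)
  YX⇒ {b} {a} (m , m∈M , a≡) = classify m∈M (≡⟦⟧⇒∣ (rep b + m) a≡)
    where
    w = rep a - rep b
    shift : ∀ w m → (w - m) + m ≡ w
    shift = solve-∀
    assoc : ∀ a b m → a - (b + m) ≡ (a - b) - m
    assoc = solve-∀
    assoc₂ : ∀ a b n m → a - (b + (n + m)) ≡ (a - b - n) - m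
    assoc₂ = solve-∀
    byG : ∀ {m} q → m ≡ + q * G → + Nx k ∣ rep a - (rep b + m) → G ∣ w
    byG q refl Nx∣ = subst (G ∣_) (shift w (+ q * G))
      (∣m∣n⇒∣m+n (subst (G ∣_) (assoc (rep a) (rep b) (+ q * G)) (Nx∣⇒G∣ Nx∣)) (divides (+ q) refl))
    byNy : ∀ {m} q → m ≡ (G - + 2) + + q * + Ny k → + Nx k ∣ rep a - (rep b + m) → + Ny k ∣ w - (G - + 2)
    byNy q refl Nx∣ = subst (+ Ny k ∣_) (shift (w - (G - + 2)) (+ q * + Ny k))
      (∣m∣n⇒∣m+n (subst (+ Ny k ∣_) (assoc₂ (rep a) (rep b) (G - + 2) (+ q * + Ny k)) (Nx∣⇒Ny∣ Nx∣))
                  (divides (+ q) refl))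
    classify : ∀ {m} → InM k m → + Nx k ∣ rep a - (rep b + m) → G ∣ w ⊎ + Ny k ∣ w - (G - + 2)
    classify m0 = inj₁ ∘ byG 0 m0≡
    classify m1 = inj₂ ∘ byNy 0 m1≡
    classify m2 = inj₁ ∘ byG 1 m2≡
    classify m3 = inj₁ ∘ byG 2 m3≡
    classify m4 = inj₂ ∘ byNy 1 m4≡
    classify m5 = inj₁ ∘ byG 3 m5≡

  Nx∣⇒YX : ∀ {b a m} n → InM k m → m ≡ n → + Nx k ∣ rep a - rep b - n → YX k b a
  Nx∣⇒YX {b} {a} n m∈M refl Nx∣ = n , m∈M , ∣⇒≡⟦⟧ (rep b + n) (subst (+ Nx k ∣_) (assoc (rep a) (rep b) n) Nx∣)
    where
    assoc : ∀ a b m → a - b - m ≡ a - (b + m)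
    assoc = solve-∀

  G∣⇒YX : ∀ {b a} → G ∣ rep a - rep b → YX k b a
  G∣⇒YX {b} {a} G∣a-b = from-residue (∣⇒∣-offset 4 G∣a-b)
    where
    from-residue : ∃[ q ] (q < 4 × + 4 * G ∣ rep a - rep b - + q * G) → YX k b a
    from-residue (0 , _ , 4G∣) = Nx∣⇒YX _ m0 m0≡ (subst (_∣ rep a - rep b - + 0 * G) (sym Nx≡4G) 4G∣)
    from-residue (1 , _ , 4G∣) = Nx∣⇒YX _ m2 m2≡ (subst (_∣ rep a - rep b - + 1 * G) (sym Nx≡4G) 4G∣)
    from-residue (2 , _ , 4G∣) = Nx∣⇒YX _ m3 m3≡ (subst (_∣ rep a - rep b - + 2 * G) (sym Nx≡4G) 4G∣)
    from-residue (3 , _ , 4G∣) = Nx∣⇒YX _ m5 m5≡ (subst (_∣ rep a - rep b - + 3 * G) (sym Nx≡4G) 4G∣)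
    from-residue (suc (suc (suc (suc _))) , s≤s (s≤s (s≤s (s≤s ()))) , _)

  Ny∣⇒YX : ∀ {b a} → + Ny k ∣ rep a - rep b - (G - + 2) → YX k b a
  Ny∣⇒YX {b} {a} Ny∣ = from-residue (∣⇒∣-offset 2 Ny∣)
    where
    assoc : ∀ w n m → w - n - m ≡ w - (n + m)
    assoc = solve-∀
    from-residue : ∃[ q ] (q < 2 × + 2 * + Ny k ∣ rep a - rep b - (G - + 2) - + q * + Ny k) → YX k b a
    from-residue (0 , _ , 2Ny∣) = Nx∣⇒YX _ m1 m1≡
      (subst₂ _∣_ (sym Nx≡2Ny) (assoc (rep a - rep b) (G - + 2) (+ 0 * + Ny k)) 2Ny∣)
    from-residue (1 , _ , 2Ny∣) = Nx∣⇒YX _ m4 m4≡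
      (subst₂ _∣_ (sym Nx≡2Ny) (assoc (rep a - rep b) (G - + 2) (+ 1 * + Ny k)) 2Ny∣)
    from-residue (suc (suc _) , s≤s (s≤s ()) , _)

  level : V k → ℤ
  level (x a) = rep a
  level (y b) = rep b - + 1

  infix 4 _≡±_
  _≡±_ : ℤ → ℕ → Set
  δ ≡± s = G ∣ δ - + s ⊎ G ∣ δ + + s

  ≡±-neg : ∀ {δ s} → δ ≡± s → - δ ≡± s
  ≡±-neg {δ} {s} (inj₁ G∣) = inj₂ (subst (G ∣_) (flip δ (+ s)) (∣m⇒∣-m G∣))
    where
    flip : ∀ δ s → - (δ - s) ≡ - δ + s
    flip = solve-∀
  ≡±-neg {δ} {s} (inj₂ G∣) = inj₁ (subst (G ∣_) (flip δ (+ s)) (∣m⇒∣-m G∣))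
    where
    flip : ∀ δ s → - (δ + s) ≡ - δ - s
    flip = solve-∀

  ≡±-sym : ∀ {a b s} → a - b ≡± s → b - a ≡± s
  ≡±-sym {a} {b} {s} = subst (_≡± s) (identity a b) ∘ ≡±-neg {a - b} {s}
    where
    identity : ∀ a b → - (a - b) ≡ b - a
    identity = solve-∀

  ∣⇒≡±0 : ∀ {w} → G ∣ w → w ≡± 0
  ∣⇒≡±0 {w} G∣w = inj₁ (subst (G ∣_) (sym (ZP.+-identityʳ w)) G∣w)

  ≡±0⇒∣ : ∀ {w} → w ≡± 0 → G ∣ w
  ≡±0⇒∣ {w} (inj₁ G∣) = subst (G ∣_) (ZP.+-identityʳ w) G∣
  ≡±0⇒∣ {w} (inj₂ G∣) = subst (G ∣_) (ZP.+-identityʳ w) G∣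

  YX⇒≡±1 : ∀ {b a} → YX k b a → level (x a) - level (y b) ≡± 1
  YX⇒≡±1 {b} {a} b~a with YX⇒ b~a
  ... | inj₁ G∣ = inj₁ (subst (G ∣_) (identity (rep a) (rep b)) G∣)
    where
    identity : ∀ a b → a - b ≡ a - (b - + 1) - + 1
    identity = solve-∀
  ... | inj₂ Ny∣ = inj₂ (subst (G ∣_) (identity (rep a) (rep b) G)
    (∣m∣n⇒∣m+n (Ny∣⇒G∣ Ny∣) (divides (+ 1) refl)))
    where
    identity : ∀ a b G → a - b - (G - + 2) + + 1 * G ≡ a - (b - + 1) + + 1
    identity = solve-∀

  Adj⇒≡±1 : ∀ {u v} → Adj k u v → level v - level u ≡± 1
  Adj⇒≡±1 {x a} {x b} (xx⁺ b≡) =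
    inj₁ (subst (G ∣_) (identity (rep b) (rep a)) (Nx∣⇒G∣ (≡⟦⟧⇒∣ (rep a + + 1) b≡)))
    where
    identity : ∀ b a → b - (a + + 1) ≡ b - a - + 1
    identity = solve-∀
  Adj⇒≡±1 {x a} {x b} (xx⁻ a≡) =
    ≡±-sym {rep a} {rep b} (inj₁ (subst (G ∣_) (identity (rep a) (rep b)) (Nx∣⇒G∣ (≡⟦⟧⇒∣ (rep b + + 1) a≡))))
    where
    identity : ∀ a b → a - (b + + 1) ≡ a - b - + 1
    identity = solve-∀
  Adj⇒≡±1 (yx b~a) = YX⇒≡±1 b~a
  Adj⇒≡±1 {x a} {y b} (xy b~a) = ≡±-sym {level (x a)} {level (y b)} (YX⇒≡±1 b~a)

  Walk⇒level : ∀ {u v m} → Walk k u v m →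
               ∃[ p ] ∃[ n ] (p N.+ n ≡ m × G ∣ level v - level u - (+ p - + n))
  Walk⇒level {u} here = 0 , 0 , refl , divides 0ℤ (identity (level u) G)
    where
    identity : ∀ u G → u - u - (+ 0 - + 0) ≡ 0ℤ * G
    identity = solve-∀
  Walk⇒level {u} {w} (step {v = v} u~v walk) with Walk⇒level walk | Adj⇒≡±1 u~v
  ... | p , n , refl , G∣ | inj₁ G∣′ = suc p , n , refl ,
    subst (G ∣_) (identity (level w) (level v) (level u) (+ p) (+ n)) (∣m∣n⇒∣m+n G∣ G∣′)
    where
    identity : ∀ w v u p n → (w - v - (p - n)) + (v - u - + 1) ≡ w - u - ((+ 1 + p) - n)
    identity = solve-∀
  ... | p , n , refl , G∣ | inj₂ G∣′ = p , suc n , NP.+-suc p n ,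
    subst (G ∣_) (identity (level w) (level v) (level u) (+ p) (+ n)) (∣m∣n⇒∣m+n G∣ G∣′)
    where
    identity : ∀ w v u p n → (w - v - (p - n)) + (v - u + + 1) ≡ w - u - (p - (+ 1 + n))
    identity = solve-∀

  G∣s-t⇒s≡t : ∀ {s t} → s ≤ k → t ≤ k → G ∣ + s - + t → s ≡ t
  G∣s-t⇒s≡t s≤k t≤k = o∣m-n⇒m≡n (NP.≤-<-trans s≤k k<g) (NP.≤-<-trans t≤k k<g)

  G∣s+t⇒s≡0∧t≡0 : ∀ {s t} → s ≤ k → t ≤ k → G ∣ + (s N.+ t) → s ≡ 0 × t ≡ 0
  G∣s+t⇒s≡0∧t≡0 {s} s≤k t≤k G∣s+t = NP.m+n≡0⇒m≡0 s s+t≡0 , NP.m+n≡0⇒n≡0 s s+t≡0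
    where
    s+t≡0 = ZP.+-injective (∣i∣<n∧n∣i⇒i≡0 (s+t<g s≤k t≤k) G∣s+t)

  ≡±-unique : ∀ {δ s s'} → δ ≡± s → δ ≡± s' → s ≤ k → s' ≤ k → s ≡ s'
  ≡±-unique {δ} {s} {s'} (inj₁ G∣) (inj₁ G∣′) s≤k s'≤k =
    sym (G∣s-t⇒s≡t s'≤k s≤k (subst (G ∣_) (identity δ (+ s) (+ s')) (∣m∣n⇒∣m-n G∣ G∣′)))
    where
    identity : ∀ δ s s' → (δ - s) - (δ - s') ≡ s' - s
    identity = solve-∀
  ≡±-unique {δ} {s} {s'} (inj₂ G∣) (inj₂ G∣′) s≤k s'≤k =
    G∣s-t⇒s≡t s≤k s'≤k (subst (G ∣_) (identity δ (+ s) (+ s')) (∣m∣n⇒∣m-n G∣ G∣′))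
    where
    identity : ∀ δ s s' → (δ + s) - (δ + s') ≡ s - s'
    identity = solve-∀
  ≡±-unique {δ} {s} {s'} (inj₁ G∣) (inj₂ G∣′) s≤k s'≤k
    with G∣s+t⇒s≡0∧t≡0 s≤k s'≤k (subst (G ∣_) (identity δ (+ s) (+ s')) (∣m∣n⇒∣m-n G∣′ G∣))
    where
    identity : ∀ δ s s' → (δ + s') - (δ - s) ≡ s + s'
    identity = solve-∀
  ... | refl , refl = refl
  ≡±-unique {δ} {s} {s'} (inj₂ G∣) (inj₁ G∣′) s≤k s'≤k
    with G∣s+t⇒s≡0∧t≡0 s≤k s'≤k (subst (G ∣_) (identity δ (+ s) (+ s')) (∣m∣n⇒∣m-n G∣ G∣′))
    where
    identity : ∀ δ s s' → (δ + s) - (δ - s') ≡ s + s'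
    identity = solve-∀
  ... | refl , refl = refl

  ≡±-exists : ∀ δ → ∃[ s ] (s ≤ k × δ ≡± s)
  ≡±-exists δ = from-residue (δ %ℕ g) (n%ℕd<d δ g) (a≡a%ℕn+[a/ℕn]*n δ g)
    where
    open ≡-Reasoning
    q = δ /ℕ g
    cancel : ∀ r q G → (r + q * G) - r ≡ q * G
    cancel = solve-∀
    regroup : ∀ r q G t → (r + q * G) + t ≡ q * G + (r + t)
    regroup = solve-∀
    collect : ∀ q G → q * G + G ≡ (q + + 1) * G
    collect = solve-∀
    from-residue : ∀ r → r < g → δ ≡ + r + q * G → ∃[ s ] (s ≤ k × δ ≡± s)
    from-residue r r<g δ≡r+qG with r N.≤? k
    ... | yes r≤k = r , r≤k , inj₁ (divides q (begin
      δ - + r               ≡⟨ cong (_- + r) δ≡r+qG ⟩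
      (+ r + q * G) - + r   ≡⟨ cancel (+ r) q G ⟩
      q * G                 ∎))
    ... | no r≰k = g N.∸ r , g-r≤k , inj₂ (divides (q + + 1) (begin
      δ + + (g N.∸ r)                  ≡⟨ cong (_+ + (g N.∸ r)) δ≡r+qG ⟩
      (+ r + q * G) + + (g N.∸ r)      ≡⟨ regroup (+ r) q G (+ (g N.∸ r)) ⟩
      q * G + (+ r + + (g N.∸ r))      ≡⟨ cong (λ t → q * G + + t) (NP.m+[n∸m]≡n (NP.<⇒≤ r<g)) ⟩
      q * G + G                        ≡⟨ collect q G ⟩
      (q + + 1) * G                    ∎))
      where
      g-r≤k : g N.∸ r ≤ k
      g-r≤k = NP.≤-trans (NP.∸-monoʳ-≤ g (NP.≰⇒> r≰k))
        (NP.≤-reflexive (trans (cong (N._∸ suc k) g≡k+k+1) (NP.m+n∸n≡m k k)))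

  ¬∣-s∧∣+s : ∀ {δ s} → 0 < s → s ≤ k → G ∣ δ - + s → ¬ G ∣ δ + + s
  ¬∣-s∧∣+s {δ} {suc s} _ s≤k G∣δ-s G∣δ+s with G∣s+t⇒s≡0∧t≡0 s≤k s≤k
    (subst (G ∣_) (identity δ (+ suc s)) (∣m∣n⇒∣m-n G∣δ+s G∣δ-s))
    where
    identity : ∀ δ s → (δ + s) - (δ - s) ≡ s + s
    identity = solve-∀
  ... | () , _

  Walk⇒parity : ∀ {u v m s} → Walk k u v m → level v - level u ≡± s → m N.+ s < g →
                ∃[ c ] m ≡ s N.+ (c N.+ c)
  Walk⇒parity {u} {v} {s = s} walk δ≡±s m+s<g with Walk⇒level walk
  ... | p , n , refl , G∣ with δ≡±s
  ...   | inj₁ G∣′ = n , (begin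
    p N.+ n         ≡⟨ cong (N._+ n) (sym s+n≡p) ⟩
    s N.+ n N.+ n   ≡⟨ NP.+-assoc s n n ⟩
    s N.+ (n N.+ n) ∎)
    where
    open ≡-Reasoning
    identity : ∀ δ p n s → (δ - (p - n)) - (δ - s) ≡ (s + n) - p
    identity = solve-∀
    s+n≡p : s N.+ n ≡ p
    s+n≡p = o∣m-n⇒m≡n
      (NP.≤-<-trans (NP.≤-trans (NP.+-monoʳ-≤ s (NP.m≤n+m n p)) (NP.≤-reflexive (NP.+-comm s (p N.+ n)))) m+s<g)
      (NP.≤-<-trans (NP.≤-trans (NP.m≤m+n p n) (NP.m≤m+n (p N.+ n) s)) m+s<g)
      (subst (G ∣_) (identity (level v - level u) (+ p) (+ n) (+ s)) (∣m∣n⇒∣m-n G∣ G∣′))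
  ...   | inj₂ G∣′ = p , (begin
    p N.+ n         ≡⟨ cong (p N.+_) (sym s+p≡n) ⟩
    p N.+ (s N.+ p) ≡⟨ regroup p s ⟩
    s N.+ (p N.+ p) ∎)
    where
    open ≡-Reasoning
    identity : ∀ δ p n s → (δ + s) - (δ - (p - n)) ≡ (s + p) - n
    identity = solve-∀
    regroup : ∀ p s → p N.+ (s N.+ p) ≡ s N.+ (p N.+ p)
    regroup = NS.solve-∀
    s+p≡n : s N.+ p ≡ n
    s+p≡n = o∣m-n⇒m≡n
      (NP.≤-<-trans (NP.≤-trans (NP.+-monoʳ-≤ s (NP.m≤m+n p n)) (NP.≤-reflexive (NP.+-comm s (p N.+ n)))) m+s<g)
      (NP.≤-<-trans (NP.≤-trans (NP.m≤n+m n p) (NP.m≤m+n (p N.+ n) s)) m+s<g)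
      (subst (G ∣_) (identity (level v - level u) (+ p) (+ n) (+ s)) (∣m∣n⇒∣m-n G∣′ G∣))

  Walk⇒≥ : ∀ {u v m s} → Walk k u v m → level v - level u ≡± s → s ≤ k → s ≤ m
  Walk⇒≥ {m = m} {s} walk δ≡±s s≤k with s N.≤? m
  ... | yes s≤m = s≤m
  ... | no s≰m with Walk⇒parity walk δ≡±s (s+t<g (NP.≤-trans (NP.<⇒≤ (NP.≰⇒> s≰m)) s≤k) s≤k)
  ...   | c , m≡ = contradiction (subst (s ≤_) (sym m≡) (NP.m≤m+n s (c N.+ c))) s≰m

  data Direction : ℤ → Set where
    forward  : Direction (+ 1)
    backward : Direction (- + 1)

  x-step : ∀ {ε a c} → Direction ε → + Nx k ∣ rep c - rep a - ε → Adj k (x a) (x c)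
  x-step {a = a} {c} forward Nx∣ = xx⁺ (∣⇒≡⟦⟧ (rep a + + 1) (subst (+ Nx k ∣_) (identity (rep c) (rep a)) Nx∣))
    where
    identity : ∀ c a → c - a - + 1 ≡ c - (a + + 1)
    identity = solve-∀
  x-step {a = a} {c} backward Nx∣ =
    xx⁻ (∣⇒≡⟦⟧ (rep c + + 1) (subst (+ Nx k ∣_) (identity (rep c) (rep a)) (∣m⇒∣-m Nx∣)))
    where
    identity : ∀ c a → - (c - a - - + 1) ≡ a - (c + + 1)
    identity = solve-∀

  x-path : ∀ n {ε a c} → Direction ε → + Nx k ∣ rep c - rep a - ε * + n → Walk k (x a) (x c) n
  x-path zero {ε} {a} {c} _ Nx∣ = subst (λ c → Walk k (x a) (x c) 0) a≡c here
    where
    identity : ∀ c a ε → c - a - ε * + 0 ≡ c - a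
    identity = solve-∀
    a≡c : a ≡ c
    a≡c = trans (sym (⟦rep⟧ a)) (sym (∣⇒≡⟦⟧ (rep a) (subst (+ Nx k ∣_) (identity (rep c) (rep a) ε) Nx∣)))
  x-path (suc n) {ε} {a} {c} dir Nx∣ =
    step (x-step dir (subst (+ Nx k ∣_) (identity₁ (rep m) (rep a) ε) m-reached))
         (x-path n dir (subst (+ Nx k ∣_) (identity₂ (rep c) (rep m) (rep a) ε (+ n)) (∣m∣n⇒∣m-n Nx∣ m-reached)))
    where
    m : Fin (Nx k)
    m = ⟦ rep a + ε ⟧
    m-reached : + Nx k ∣ rep m - (rep a + ε)
    m-reached = ∣rep⟦z⟧-z (rep a + ε)
    identity₁ : ∀ m a ε → m - (a + ε) ≡ m - a - ε
    identity₁ = solve-∀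
    identity₂ : ∀ c m a ε n → (c - a - ε * (+ 1 + n)) - (m - (a + ε)) ≡ c - m - ε * n
    identity₂ = solve-∀

  x-step-to : ∀ {ε a c} → Direction ε → c ≡ ⟦ rep a + ε ⟧ → Adj k (x a) (x c)
  x-step-to {ε} {a} {c} dir c≡ =
    x-step dir (subst (+ Nx k ∣_) (identity (rep c) (rep a) ε) (≡⟦⟧⇒∣ (rep a + ε) c≡))
    where
    identity : ∀ c a ε → c - (a + ε) ≡ c - a - ε
    identity = solve-∀

  via-y : ∀ {a b c} → YX k b a → YX k b c → Walk k (x a) (x c) 2
  via-y b~a b~c = step (xy b~a) (step (yx b~c) here)

  jump₀ : ∀ {a c} → G ∣ rep c - rep a → Walk k (x a) (x c) 2
  jump₀ {a} {c} G∣c-a = via-y (G∣⇒YX {b} {a} G∣a-b) (G∣⇒YX {b} {c} G∣c-b)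
    where
    b : Fin (Ny k)
    b = ⟦ rep a ⟧
    flip : ∀ b a → - (b - a) ≡ a - b
    flip = solve-∀
    G∣a-b : G ∣ rep a - rep b
    G∣a-b = subst (G ∣_) (flip (rep b) (rep a)) (∣m⇒∣-m (Ny∣⇒G∣ (∣rep⟦z⟧-z (rep a))))
    telescope : ∀ c a b → (c - a) + (a - b) ≡ c - b
    telescope = solve-∀
    G∣c-b : G ∣ rep c - rep b
    G∣c-b = subst (G ∣_) (telescope (rep c) (rep a) (rep b)) (∣m∣n⇒∣m+n G∣c-a G∣a-b)

  -- via y_{a - G + 2}, adjacent to x_a and to x_{a+2} through m = 2k - 1 and m = 2k + 1
  jump₊₂ : ∀ {a c} → G ∣ rep c - rep a - + 2 → Walk k (x a) (x c) 2
  jump₊₂ {a} {c} G∣c-a-2 = via-y (Ny∣⇒YX {b} {a} Ny∣a-b-[G-2]) (G∣⇒YX {b} {c} G∣c-b)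
    where
    b : Fin (Ny k)
    b = ⟦ rep a - G + + 2 ⟧
    flip : ∀ b a G → - (b - (a - G + + 2)) ≡ a - b - (G - + 2)
    flip = solve-∀
    Ny∣a-b-[G-2] : + Ny k ∣ rep a - rep b - (G - + 2)
    Ny∣a-b-[G-2] = subst (+ Ny k ∣_) (flip (rep b) (rep a) G) (∣m⇒∣-m (∣rep⟦z⟧-z (rep a - G + + 2)))
    telescope : ∀ c a b G → (c - a - + 2) + (a - b - (G - + 2)) + + 1 * G ≡ c - b
    telescope = solve-∀
    G∣c-b : G ∣ rep c - rep b
    G∣c-b = subst (G ∣_) (telescope (rep c) (rep a) (rep b) G)
      (∣m∣n⇒∣m+n (∣m∣n⇒∣m+n G∣c-a-2 (Ny∣⇒G∣ Ny∣a-b-[G-2])) (divides (+ 1) refl))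

  jump₋₂ : ∀ {a c} → G ∣ rep c - rep a + + 2 → Walk k (x a) (x c) 2
  jump₋₂ {a} {c} G∣c-a+2 = via-y (G∣⇒YX {b} {a} G∣a-b) (Ny∣⇒YX {b} {c} Ny∣c-b-[G-2])
    where
    b : Fin (Ny k)
    b = ⟦ rep c - G + + 2 ⟧
    flip : ∀ b c G → - (b - (c - G + + 2)) ≡ c - b - (G - + 2)
    flip = solve-∀
    Ny∣c-b-[G-2] : + Ny k ∣ rep c - rep b - (G - + 2)
    Ny∣c-b-[G-2] = subst (+ Ny k ∣_) (flip (rep b) (rep c) G) (∣m⇒∣-m (∣rep⟦z⟧-z (rep c - G + + 2)))
    telescope : ∀ c a b G → - (c - a + + 2) + (c - b - (G - + 2)) + + 1 * G ≡ a - b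
    telescope = solve-∀
    G∣a-b : G ∣ rep a - rep b
    G∣a-b = subst (G ∣_) (telescope (rep c) (rep a) (rep b) G)
      (∣m∣n⇒∣m+n (∣m∣n⇒∣m+n (∣m⇒∣-m G∣c-a+2) (Ny∣⇒G∣ Ny∣c-b-[G-2])) (divides (+ 1) refl))

  x-walk : ∀ s {a c} → rep c - rep a ≡± (2 N.+ s) → Walk k (x a) (x c) (2 N.+ s)
  x-walk s {a} {c} (inj₁ G∣) = subst (Walk k (x a) (x c)) (NP.+-comm s 2)
    (x-path s forward (subst (+ Nx k ∣_) (identity₁ (rep m) (rep a) (+ s)) (∣rep⟦z⟧-z (rep a + + 1 * + s)))
     ++ʷ jump₊₂ (subst (G ∣_) (identity₂ (rep c) (rep a) (rep m) (+ s))
                 (∣m∣n⇒∣m-n G∣ (Nx∣⇒G∣ (∣rep⟦z⟧-z (rep a + + 1 * + s))))))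
    where
    m : Fin (Nx k)
    m = ⟦ rep a + + 1 * + s ⟧
    identity₁ : ∀ m a s → m - (a + + 1 * s) ≡ m - a - + 1 * s
    identity₁ = solve-∀
    identity₂ : ∀ c a m s → (c - a - (+ 2 + s)) - (m - (a + + 1 * s)) ≡ c - m - + 2
    identity₂ = solve-∀
  x-walk s {a} {c} (inj₂ G∣) = subst (Walk k (x a) (x c)) (NP.+-comm s 2)
    (x-path s backward (subst (+ Nx k ∣_) (identity₁ (rep m) (rep a) (+ s)) (∣rep⟦z⟧-z (rep a + - + 1 * + s)))
     ++ʷ jump₋₂ (subst (G ∣_) (identity₂ (rep c) (rep a) (rep m) (+ s))
                 (∣m∣n⇒∣m-n G∣ (Nx∣⇒G∣ (∣rep⟦z⟧-z (rep a + - + 1 * + s))))))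
    where
    m : Fin (Nx k)
    m = ⟦ rep a + - + 1 * + s ⟧
    identity₁ : ∀ m a s → m - (a + - + 1 * s) ≡ m - a - - + 1 * s
    identity₁ = solve-∀
    identity₂ : ∀ c a m s → (c - a + (+ 2 + s)) - (m - (a + - + 1 * s)) ≡ c - m + + 2
    identity₂ = solve-∀

  y-walk : ∀ s {a b} → level (y b) - rep a ≡± (3 N.+ s) → Walk k (x a) (y b) (3 N.+ s)
  y-walk s {a} {b} (inj₁ G∣) = subst (Walk k (x a) (y b)) (NP.+-comm (2 N.+ s) 1)
    (x-walk s {a} {c} (inj₁ (subst (G ∣_) (identity₁ (rep c) (rep b) (rep a) G (+ s))
       (∣m∣n⇒∣m+n (∣m∣n⇒∣m+n (Nx∣⇒G∣ c-reached) G∣) (divides (+ 1) refl))))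
     ++ʷ step (xy (Ny∣⇒YX {b} {c} (subst (+ Ny k ∣_) (identity₂ (rep c) (rep b) G) (Nx∣⇒Ny∣ c-reached)))) here)
    where
    c : Fin (Nx k)
    c = ⟦ rep b + (G - + 2) ⟧
    c-reached : + Nx k ∣ rep c - (rep b + (G - + 2))
    c-reached = ∣rep⟦z⟧-z (rep b + (G - + 2))
    identity₁ : ∀ c b a G s → (c - (b + (G - + 2))) + ((b - + 1) - a - (+ 3 + s)) + + 1 * G ≡ c - a - (+ 2 + s)
    identity₁ = solve-∀
    identity₂ : ∀ c b G → c - (b + (G - + 2)) ≡ c - b - (G - + 2)
    identity₂ = solve-∀
  y-walk s {a} {b} (inj₂ G∣) = subst (Walk k (x a) (y b)) (NP.+-comm (2 N.+ s) 1)
    (x-walk s {a} {c} (inj₂ (subst (G ∣_) (identity (rep c) (rep b) (rep a) (+ s))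
       (∣m∣n⇒∣m+n (Nx∣⇒G∣ c-reached) G∣)))
     ++ʷ step (xy (G∣⇒YX {b} {c} (Nx∣⇒G∣ c-reached))) here)
    where
    c : Fin (Nx k)
    c = ⟦ rep b ⟧
    c-reached : + Nx k ∣ rep c - rep b
    c-reached = ∣rep⟦z⟧-z (rep b)
    identity : ∀ c b a s → (c - b) + ((b - + 1) - a + (+ 3 + s)) ≡ c - a + (+ 2 + s)
    identity = solve-∀

  ≡±⇒¬Walk-suc : ∀ {u v s} → s ≤ 3 → level v - level u ≡± s → ¬ Walk k u v (suc s)
  ≡±⇒¬Walk-suc {s = s} s≤3 δ≡±s walk
    with Walk⇒parity walk δ≡±s (≤8⇒<g (NP.≤-trans (NP.+-mono-≤ (s≤s s≤3) s≤3) (NP.n≤1+n 7)))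
  ... | c , 1+s≡s+2c = odd c (NP.+-cancelˡ-≡ s 1 (c N.+ c) (trans (NP.+-comm s 1) 1+s≡s+2c))
    where
    odd : ∀ c → 1 ≢ c N.+ c
    odd zero ()
    odd (suc c) 1≡ = contradiction (trans 1≡ (cong suc (NP.+-suc c c))) λ ()

  G∣⇒Ny∣⊎Ny∣-G : ∀ {w} → G ∣ w → + Ny k ∣ w ⊎ + Ny k ∣ w - G
  G∣⇒Ny∣⊎Ny∣-G {w} G∣w with ∣⇒∣-offset 2 G∣w
  ... | 0 , _ , 2G∣ = inj₁ (subst₂ _∣_ (sym Ny≡2G) (identity₀ w G) 2G∣)
    where
    identity₀ : ∀ w G → w - + 0 * G ≡ w
    identity₀ = solve-∀
  ... | 1 , _ , 2G∣ = inj₂ (subst₂ _∣_ (sym Ny≡2G) (identity₁ w G) 2G∣)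
    where
    identity₁ : ∀ w G → w - + 1 * G ≡ w - G
    identity₁ = solve-∀
  ... | suc (suc _) , s≤s (s≤s ()) , _

  ¬YX : ∀ {b c} n → n ≤ 2 → + Ny k ∣ rep c - rep b + + (2 N.+ n) → ¬ YX k b c
  ¬YX {b} {c} n n≤2 Ny∣ b~c with YX⇒ b~c
  ... | inj₁ G∣c-b = ¬G∣ (λ ()) (≤8⇒<g (NP.≤-trans (s≤s (s≤s n≤2)) (NP.m≤m+n 4 4)))
    (subst (G ∣_) (cancel (rep c - rep b) (+ (2 N.+ n))) (∣m∣n⇒∣m-n (Ny∣⇒G∣ Ny∣) G∣c-b))
    where
    cancel : ∀ w t → (w + t) - w ≡ t
    cancel = solve-∀
  ... | inj₂ Ny∣′ = n+g≢0 (∣i∣<n∧n∣i⇒i≡0 n+g<Ny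
    (subst (+ Ny k ∣_) (cancel (rep c - rep b) (+ n) G) (∣m∣n⇒∣m-n Ny∣ Ny∣′)))
    where
    cancel : ∀ w n G → (w + (+ 2 + n)) - (w - (G - + 2)) ≡ n + G
    cancel = solve-∀
    n+g≢0 : + (n N.+ g) ≢ 0ℤ
    n+g≢0 eq = contradiction (trans (sym g≡k+k+1) (NP.m+n≡0⇒n≡0 n (ZP.+-injective eq))) λ ()
    Ny≡ : Ny k ≡ suc (2 N.* k) N.+ g
    Ny≡ = identity k
      where
      identity : ∀ k → 2 N.+ 4 N.* k ≡ suc (2 N.* k) N.+ (2 N.* k N.+ 1)
      identity = NS.solve-∀
    n+g<Ny : n N.+ g < Ny k
    n+g<Ny = subst (n N.+ g <_) (sym Ny≡)
      (NP.+-monoˡ-< g (s≤s (NP.≤-trans n≤2 (NP.≤-trans k≥2 (NP.m≤m+n k (k N.+ 0))))))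

  -- Distances from x_j

  module Distances (j : Fin (Nx k)) where

    J : ℤ
    J = rep j

    δ : V k → ℤ
    δ v = level v - J

    Neighbour : Fin (Nx k) → Set
    Neighbour a = a ≡ ⟦ J + + 1 ⟧ ⊎ a ≡ ⟦ J - + 1 ⟧

    -- XDist a d (YDist b d) holds exactly when d is the distance from x_j to x_a (to y_b)
    data XDist (a : Fin (Nx k)) : ℕ → Set where
      at-j       : a ≡ j → XDist a 0
      neighbour  : Neighbour a → XDist a 1
      same-level : G ∣ δ (x a) → a ≢ j → XDist a 2
      level±1    : δ (x a) ≡± 1 → ¬ Neighbour a → XDist a 3
      level±     : ∀ {s} → 2 ≤ s → s ≤ k → δ (x a) ≡± s → XDist a s

    data YDist (b : Fin (Ny k)) : ℕ → Set where
      same-level : G ∣ δ (y b) → YDist b 2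
      level±1    : δ (y b) ≡± 1 → b ≢ ⟦ J + + 2 ⟧ → YDist b 1
      at-J+2     : b ≡ ⟦ J + + 2 ⟧ → YDist b 3
      level±2    : δ (y b) ≡± 2 → b ≢ ⟦ J + + 3 ⟧ → YDist b 2
      at-J+3     : b ≡ ⟦ J + + 3 ⟧ → YDist b 4
      level±     : ∀ {s} → 3 ≤ s → s ≤ k → δ (y b) ≡± s → YDist b s

    ≡⟦J+⟧⇒∣ : ∀ {a : Fin (Nx k)} e → a ≡ ⟦ J + e ⟧ → G ∣ δ (x a) - e
    ≡⟦J+⟧⇒∣ {a} e a≡ = subst (G ∣_) (identity (rep a) J e) (Nx∣⇒G∣ (≡⟦⟧⇒∣ (J + e) a≡))
      where
      identity : ∀ a J e → a - (J + e) ≡ a - J - e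
      identity = solve-∀

    Neighbour⇒≡±1 : ∀ {a} → Neighbour a → δ (x a) ≡± 1
    Neighbour⇒≡±1 (inj₁ a≡) = inj₁ (≡⟦J+⟧⇒∣ (+ 1) a≡)
    Neighbour⇒≡±1 (inj₂ a≡) = inj₂ (≡⟦J+⟧⇒∣ (- + 1) a≡)

    Dist-neighbour : ∀ {a} → Neighbour a → Dist k (x j) (x a) 1
    Dist-neighbour nb = Walk-shortest (step (edge nb) here) (λ walk → Walk⇒≥ walk (Neighbour⇒≡±1 nb) k≥1)
      where
      edge : ∀ {a} → Neighbour a → Adj k (x j) (x a)
      edge (inj₁ a≡) = x-step-to forward a≡
      edge (inj₂ a≡) = x-step-to backward a≡

    Dist-same-level : ∀ {a} → G ∣ δ (x a) → a ≢ j → Dist k (x j) (x a) 2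
    Dist-same-level G∣δ a≢j = jump₀ G∣δ , shorter
      where
      shorter : ∀ m → m < 2 → ¬ Walk k (x j) (x _) m
      shorter zero _ here = a≢j refl
      shorter (suc zero) _ walk = ≡±⇒¬Walk-suc z≤n (∣⇒≡±0 G∣δ) walk
      shorter (suc (suc _)) (s≤s (s≤s ()))

    Dist-level±1 : ∀ {a} → δ (x a) ≡± 1 → ¬ Neighbour a → Dist k (x j) (x a) 3
    Dist-level±1 {a} δ≡±1 ¬nb = walk δ≡±1 , shorter
      where
      walk : δ (x a) ≡± 1 → Walk k (x j) (x a) 3
      walk (inj₁ G∣) = step (x-step-to backward refl) (jump₊₂ (subst (G ∣_) (identity (rep a) J (rep c))
          (∣m∣n⇒∣m-n G∣ (Nx∣⇒G∣ (∣rep⟦z⟧-z (J - + 1))))))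
        where
        c = ⟦_⟧ {Nx k} (J - + 1)
        identity : ∀ a J c → (a - J - + 1) - (c - (J - + 1)) ≡ a - c - + 2
        identity = solve-∀
      walk (inj₂ G∣) = step (x-step-to forward refl) (jump₋₂ (subst (G ∣_) (identity (rep a) J (rep c))
          (∣m∣n⇒∣m-n G∣ (Nx∣⇒G∣ (∣rep⟦z⟧-z (J + + 1))))))
        where
        c = ⟦_⟧ {Nx k} (J + + 1)
        identity : ∀ a J c → (a - J + + 1) - (c - (J + + 1)) ≡ a - c + + 2
        identity = solve-∀
      shorter : ∀ m → m < 3 → ¬ Walk k (x j) (x a) m
      shorter zero _ walk = contradiction (Walk⇒≥ walk δ≡±1 k≥1) λ ()
      shorter (suc zero) _ (step (xx⁺ a≡) here) = ¬nb (inj₁ a≡)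
      shorter (suc zero) _ (step (xx⁻ j≡) here) = ¬nb (inj₂ (∣⇒≡⟦⟧ (J - + 1)
        (subst (+ Nx k ∣_) (flip J (rep a)) (∣m⇒∣-m (≡⟦⟧⇒∣ (rep a + + 1) j≡)))))
        where
        flip : ∀ J a → - (J - (a + + 1)) ≡ a - (J - + 1)
        flip = solve-∀
      shorter (suc (suc zero)) _ walk = ≡±⇒¬Walk-suc (s≤s z≤n) δ≡±1 walk
      shorter (suc (suc (suc _))) (s≤s (s≤s (s≤s ())))

    Dist-level± : ∀ {a s} → 2 ≤ s → s ≤ k → δ (x a) ≡± s → Dist k (x j) (x a) s
    Dist-level± (s≤s (s≤s _)) s≤k δ≡±s = Walk-shortest (x-walk _ δ≡±s) (λ walk → Walk⇒≥ walk δ≡±s s≤k)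

    XDist⇒Dist : ∀ {a d} → XDist a d → Dist k (x j) (x a) d
    XDist⇒Dist (at-j refl)          = here , λ _ ()
    XDist⇒Dist (neighbour nb)       = Dist-neighbour nb
    XDist⇒Dist (same-level G∣δ a≢j) = Dist-same-level G∣δ a≢j
    XDist⇒Dist (level±1 δ≡±1 ¬nb)   = Dist-level±1 δ≡±1 ¬nb
    XDist⇒Dist (level± 2≤s s≤k δ≡±s) = Dist-level± 2≤s s≤k δ≡±s

    ≡⟦J+⟧⇒Ny∣ : ∀ {b : Fin (Ny k)} e → b ≡ ⟦ J + e ⟧ → + Ny k ∣ rep b - (J + e)
    ≡⟦J+⟧⇒Ny∣ e = ≡⟦⟧⇒∣ (J + e)

    Ny∣2G : + Ny k ∣ + 2 * G
    Ny∣2G = divides (+ 1) (trans (sym Ny≡2G) (sym (ZP.*-identityˡ (+ Ny k))))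

    Dist-y-same-level : ∀ {b} → G ∣ δ (y b) → Dist k (x j) (y b) 2
    Dist-y-same-level {b} G∣δ = walk , shorter
      where
      c = ⟦_⟧ {Nx k} (J + + 1)
      identity : ∀ c J b → (c - (J + + 1)) - ((b - + 1) - J) ≡ c - b
      identity = solve-∀
      walk : Walk k (x j) (y b) 2
      walk = step (x-step-to forward refl) (step (xy (G∣⇒YX {b} {c}
        (subst (G ∣_) (identity (rep c) J (rep b)) (∣m∣n⇒∣m-n (Nx∣⇒G∣ (∣rep⟦z⟧-z (J + + 1))) G∣δ)))) here)
      shorter : ∀ m → m < 2 → ¬ Walk k (x j) (y b) m
      shorter zero _ ()
      shorter (suc zero) _ walk = ≡±⇒¬Walk-suc z≤n (∣⇒≡±0 G∣δ) walk
      shorter (suc (suc _)) (s≤s (s≤s ()))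

    Dist-y-level±1 : ∀ {b} → δ (y b) ≡± 1 → b ≢ ⟦ J + + 2 ⟧ → Dist k (x j) (y b) 1
    Dist-y-level±1 {b} δ≡±1 b≢ = step (xy (edge δ≡±1)) here , λ { zero _ () ; (suc _) (s≤s ()) }
      where
      edge : δ (y b) ≡± 1 → YX k b j
      edge (inj₂ G∣) = G∣⇒YX {b} {j} (subst (G ∣_) (flip (rep b) J) (∣m⇒∣-m G∣))
        where
        flip : ∀ b J → - ((b - + 1) - J + + 1) ≡ J - b
        flip = solve-∀
      edge (inj₁ G∣) with G∣⇒Ny∣⊎Ny∣-G (subst (G ∣_) (identity (rep b) J) G∣)
        where
        identity : ∀ b J → (b - + 1) - J - + 1 ≡ b - (J + + 2)
        identity = solve-∀
      ... | inj₁ Ny∣ = contradiction (∣⇒≡⟦⟧ (J + + 2) Ny∣) b≢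
      ... | inj₂ Ny∣ = Ny∣⇒YX {b} {j} (subst (+ Ny k ∣_) (identity (rep b) J G) (∣m∣n⇒∣m-n (∣m⇒∣-m Ny∣) Ny∣2G))
        where
        identity : ∀ b J G → - (b - (J + + 2) - G) - + 2 * G ≡ J - b - (G - + 2)
        identity = solve-∀

    along-then-up : ∀ n {b} → b ≡ ⟦ J + + n ⟧ → Walk k (x j) (y b) (n N.+ 1)
    along-then-up n {b} b≡ =
      x-path n forward (subst (+ Nx k ∣_) (identity₁ (rep c) J (+ n)) (∣rep⟦z⟧-z (J + + n)))
      ++ʷ step (xy (G∣⇒YX {b} {c} (subst (G ∣_) (identity₂ (rep c) J (rep b) (+ n))
            (∣m∣n⇒∣m-n (Nx∣⇒G∣ (∣rep⟦z⟧-z (J + + n))) (Ny∣⇒G∣ (≡⟦J+⟧⇒Ny∣ (+ n) b≡)))))) here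
      where
      c = ⟦_⟧ {Nx k} (J + + n)
      identity₁ : ∀ c J n → c - (J + n) ≡ c - J - + 1 * n
      identity₁ = solve-∀
      identity₂ : ∀ c J b n → (c - (J + n)) - (b - (J + n)) ≡ c - b
      identity₂ = solve-∀

    ≡⟦J+1+s⟧⇒∣ : ∀ {b} s → b ≡ ⟦ J + + suc s ⟧ → G ∣ δ (y b) - + s
    ≡⟦J+1+s⟧⇒∣ {b} s b≡ = subst (G ∣_) (identity (rep b) J (+ s)) (Ny∣⇒G∣ (≡⟦J+⟧⇒Ny∣ (+ suc s) b≡))
      where
      identity : ∀ b J s → b - (J + (+ 1 + s)) ≡ (b - + 1) - J - s
      identity = solve-∀

    ≡⟦J+1+s⟧⇒≡±s : ∀ {b} s → b ≡ ⟦ J + + suc s ⟧ → δ (y b) ≡± s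
    ≡⟦J+1+s⟧⇒≡±s s = inj₁ ∘ ≡⟦J+1+s⟧⇒∣ s

    Dist-y-at-J+2 : ∀ {b} → b ≡ ⟦ J + + 2 ⟧ → Dist k (x j) (y b) 3
    Dist-y-at-J+2 {b} b≡ = along-then-up 2 b≡ , shorter
      where
      flip : ∀ b J → - (b - (J + + 2)) ≡ J - b + + 2
      flip = solve-∀
      shorter : ∀ m → m < 3 → ¬ Walk k (x j) (y b) m
      shorter zero _ ()
      shorter (suc zero) _ (step (xy b~j) here) =
        ¬YX 0 z≤n (subst (+ Ny k ∣_) (flip (rep b) J) (∣m⇒∣-m (≡⟦J+⟧⇒Ny∣ (+ 2) b≡))) b~j
      shorter (suc (suc zero)) _ walk = ≡±⇒¬Walk-suc (s≤s z≤n) (≡⟦J+1+s⟧⇒≡±s 1 b≡) walk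
      shorter (suc (suc (suc _))) (s≤s (s≤s (s≤s ())))

    Dist-y-level±2 : ∀ {b} → δ (y b) ≡± 2 → b ≢ ⟦ J + + 3 ⟧ → Dist k (x j) (y b) 2
    Dist-y-level±2 {b} δ≡±2 b≢ = Walk-shortest (walk δ≡±2) (λ walk → Walk⇒≥ walk δ≡±2 k≥2)
      where
      walk : δ (y b) ≡± 2 → Walk k (x j) (y b) 2
      walk (inj₂ G∣) = step (x-step-to backward refl) (step (xy (G∣⇒YX {b} {c}
          (subst (G ∣_) (identity (rep c) J (rep b)) (∣m∣n⇒∣m-n (Nx∣⇒G∣ (∣rep⟦z⟧-z (J - + 1))) G∣)))) here)
        where
        c = ⟦_⟧ {Nx k} (J - + 1)
        identity : ∀ c J b → (c - (J - + 1)) - ((b - + 1) - J + + 2) ≡ c - b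
        identity = solve-∀
      walk (inj₁ G∣) with G∣⇒Ny∣⊎Ny∣-G (subst (G ∣_) (identity (rep b) J) G∣)
        where
        identity : ∀ b J → (b - + 1) - J - + 2 ≡ b - (J + + 3)
        identity = solve-∀
      ... | inj₁ Ny∣ = contradiction (∣⇒≡⟦⟧ (J + + 3) Ny∣) b≢
      ... | inj₂ Ny∣ = step (x-step-to forward refl) (step (xy (Ny∣⇒YX {b} {c}
          (subst (+ Ny k ∣_) (identity (rep c) J (rep b) G)
            (∣m∣n⇒∣m-n (∣m∣n⇒∣m-n (Nx∣⇒Ny∣ (∣rep⟦z⟧-z (J + + 1))) Ny∣) Ny∣2G)))) here)
        where
        c = ⟦_⟧ {Nx k} (J + + 1)
        identity : ∀ c J b G → (c - (J + + 1)) - (b - (J + + 3) - G) - + 2 * G ≡ c - b - (G - + 2)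
        identity = solve-∀

    Dist-y-at-J+3 : ∀ {b} → b ≡ ⟦ J + + 3 ⟧ → Dist k (x j) (y b) 4
    Dist-y-at-J+3 {b} b≡ = along-then-up 3 b≡ , shorter
      where
      δ≡±2 = ≡⟦J+1+s⟧⇒≡±s 2 b≡
      Ny∣b-J-3 = ≡⟦J+⟧⇒Ny∣ (+ 3) b≡
      identity⁺ : ∀ c J b → (c - (J + + 1)) - (b - (J + + 3)) ≡ c - b + + 2
      identity⁺ = solve-∀
      identity⁻ : ∀ c J b → - (J - (c + + 1)) - (b - (J + + 3)) ≡ c - b + + 4
      identity⁻ = solve-∀
      shorter : ∀ m → m < 4 → ¬ Walk k (x j) (y b) m
      shorter zero _ ()
      shorter (suc zero) _ walk = contradiction (Walk⇒≥ walk δ≡±2 k≥2) λ { (s≤s ()) }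
      shorter (suc (suc zero)) _ (step (xx⁺ {b = c} c≡) (step (xy b~c) here)) =
        ¬YX 0 z≤n (subst (+ Ny k ∣_) (identity⁺ (rep c) J (rep b))
          (∣m∣n⇒∣m-n (Nx∣⇒Ny∣ (≡⟦⟧⇒∣ (J + + 1) c≡)) Ny∣b-J-3)) b~c
      shorter (suc (suc zero)) _ (step (xx⁻ {b = c} j≡) (step (xy b~c) here)) =
        ¬YX 2 (s≤s (s≤s z≤n)) (subst (+ Ny k ∣_) (identity⁻ (rep c) J (rep b))
          (∣m∣n⇒∣m-n (∣m⇒∣-m (Nx∣⇒Ny∣ (≡⟦⟧⇒∣ (rep c + + 1) j≡))) Ny∣b-J-3)) b~c
      shorter (suc (suc zero)) _ (step (xy _) (step () here))
      shorter (suc (suc (suc zero))) _ walk = ≡±⇒¬Walk-suc (s≤s (s≤s z≤n)) δ≡±2 walk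
      shorter (suc (suc (suc (suc _)))) (s≤s (s≤s (s≤s (s≤s ()))))

    Dist-y-level± : ∀ {b s} → 3 ≤ s → s ≤ k → δ (y b) ≡± s → Dist k (x j) (y b) s
    Dist-y-level± (s≤s (s≤s (s≤s _))) s≤k δ≡±s = Walk-shortest (y-walk _ δ≡±s) (λ walk → Walk⇒≥ walk δ≡±s s≤k)

    YDist⇒Dist : ∀ {b d} → YDist b d → Dist k (x j) (y b) d
    YDist⇒Dist (same-level G∣δ)      = Dist-y-same-level G∣δ
    YDist⇒Dist (level±1 δ≡±1 b≢)     = Dist-y-level±1 δ≡±1 b≢
    YDist⇒Dist (at-J+2 b≡)           = Dist-y-at-J+2 b≡
    YDist⇒Dist (level±2 δ≡±2 b≢)     = Dist-y-level±2 δ≡±2 b≢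
    YDist⇒Dist (at-J+3 b≡)           = Dist-y-at-J+3 b≡
    YDist⇒Dist (level± 3≤s s≤k δ≡±s) = Dist-y-level± 3≤s s≤k δ≡±s

    classify-x : ∀ a → ∃ (XDist a)
    classify-x a with a F.≟ j | a F.≟ ⟦ J + + 1 ⟧ | a F.≟ ⟦ J - + 1 ⟧
    ... | yes a≡j | _      | _      = 0 , at-j a≡j
    ... | no _    | yes a≡ | _      = 1 , neighbour (inj₁ a≡)
    ... | no _    | no _   | yes a≡ = 1 , neighbour (inj₂ a≡)
    ... | no a≢j  | no a≢₊ | no a≢₋ with ≡±-exists (δ (x a))
    ...   | zero , _ , δ≡±0          = 2 , same-level (≡±0⇒∣ δ≡±0) a≢j
    ...   | suc zero , _ , δ≡±1      = 3 , level±1 δ≡±1 Data.Sum.[ a≢₊ , a≢₋ ]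
    ...   | suc (suc s) , s≤k , δ≡±s = 2 N.+ s , level± (s≤s (s≤s z≤n)) s≤k δ≡±s

    classify-y : ∀ b → ∃ (YDist b)
    classify-y b with b F.≟ ⟦ J + + 2 ⟧ | b F.≟ ⟦ J + + 3 ⟧
    ... | yes b≡ | _      = 3 , at-J+2 b≡
    ... | no _   | yes b≡ = 4 , at-J+3 b≡
    ... | no b≢₂ | no b≢₃ with ≡±-exists (δ (y b))
    ...   | zero , _ , δ≡±0                = 2 , same-level (≡±0⇒∣ δ≡±0)
    ...   | suc zero , _ , δ≡±1            = 1 , level±1 δ≡±1 b≢₂
    ...   | suc (suc zero) , _ , δ≡±2      = 2 , level±2 δ≡±2 b≢₃
    ...   | suc (suc (suc s)) , s≤k , δ≡±s = 3 N.+ s , level± (s≤s (s≤s (s≤s z≤n))) s≤k δ≡±s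

    Dist-x⇔XDist : ∀ a d → Dist k (x j) (x a) d ⇔ XDist a d
    Dist-x⇔XDist a d = mk⇔
      (λ dist → let (d′ , xd′) = classify-x a in subst (XDist a) (Dist-unique (XDist⇒Dist xd′) dist) xd′)
      XDist⇒Dist

    Dist-y⇔YDist : ∀ b d → Dist k (x j) (y b) d ⇔ YDist b d
    Dist-y⇔YDist b d = mk⇔
      (λ dist → let (d′ , yd′) = classify-y b in subst (YDist b) (Dist-unique (YDist⇒Dist yd′) dist) yd′)
      YDist⇒Dist

    -- Spheres

    module CX = Cosets {Nx k} G (divides (+ 4) Nx≡4G)
    module CY = Cosets {Ny k} G (divides (+ 2) Ny≡2G)

    coset-x : ∀ c → CX.IsCoset (c +S (J +S ⟨ G ⟩)) (c + (J + 0ℤ))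
    coset-x c = CX.+S-isCoset {d = J + 0ℤ} c (CX.+S-isCoset {d = 0ℤ} J CX.⟨⟩-isCoset)

    coset-y : ∀ c → CY.IsCoset (c +S (J +S (+ 1 +S ⟨ G ⟩))) (c + (J + (+ 1 + 0ℤ)))
    coset-y c = CY.+S-isCoset {d = J + (+ 1 + 0ℤ)} c
      (CY.+S-isCoset {d = + 1 + 0ℤ} J (CY.+S-isCoset {d = 0ℤ} (+ 1) CY.⟨⟩-isCoset))

    punctured-x : ∀ c → CX.IsPuncturedCoset (c +S (J +S ⟨ G ⟩*)) (c + (J + 0ℤ))
    punctured-x c = CX.+S-isPuncturedCoset {d = J + 0ℤ} c
      (CX.+S-isPuncturedCoset {d = 0ℤ} J CX.⟨⟩*-isPuncturedCoset)

    coset⁺-x⇔ : ∀ s a → (+ s +S (J +S ⟨ G ⟩)) a ⇔ (G ∣ δ (x a) - + s)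
    coset⁺-x⇔ s a = ⇔.trans (coset-x (+ s) a) (∣-resp-≡ (identity (rep a) J (+ s)))
      where
      identity : ∀ a J s → a - (s + (J + 0ℤ)) ≡ a - J - s
      identity = solve-∀

    coset⁻-x⇔ : ∀ s a → (- + s +S (J +S ⟨ G ⟩)) a ⇔ (G ∣ δ (x a) + + s)
    coset⁻-x⇔ s a = ⇔.trans (coset-x (- + s) a) (∣-resp-≡ (identity (rep a) J (+ s)))
      where
      identity : ∀ a J s → a - (- s + (J + 0ℤ)) ≡ a - J + s
      identity = solve-∀

    ±coset-x⇔ : ∀ s a → (± + s +S (J +S ⟨ G ⟩)) a ⇔ δ (x a) ≡± s
    ±coset-x⇔ s a = coset⁺-x⇔ s a ⊎-⇔ coset⁻-x⇔ s a

    coset⁺-y⇔ : ∀ s b → (+ s +S (J +S (+ 1 +S ⟨ G ⟩))) b ⇔ (G ∣ δ (y b) - + s)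
    coset⁺-y⇔ s b = ⇔.trans (coset-y (+ s) b) (∣-resp-≡ (identity (rep b) J (+ s)))
      where
      identity : ∀ b J s → b - (s + (J + (+ 1 + 0ℤ))) ≡ (b - + 1) - J - s
      identity = solve-∀

    coset⁻-y⇔ : ∀ s b → (- + s +S (J +S (+ 1 +S ⟨ G ⟩))) b ⇔ (G ∣ δ (y b) + + s)
    coset⁻-y⇔ s b = ⇔.trans (coset-y (- + s) b) (∣-resp-≡ (identity (rep b) J (+ s)))
      where
      identity : ∀ b J s → b - (- s + (J + (+ 1 + 0ℤ))) ≡ (b - + 1) - J + s
      identity = solve-∀

    ±coset-y⇔ : ∀ s b → (± + s +S (J +S (+ 1 +S ⟨ G ⟩))) b ⇔ δ (y b) ≡± s
    ±coset-y⇔ s b = coset⁺-y⇔ s b ⊎-⇔ coset⁻-y⇔ s b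

    ⟦J+0⟧≡j : ⟦ J + 0ℤ ⟧ ≡ j
    ⟦J+0⟧≡j = trans (cong ⟦_⟧ (ZP.+-identityʳ J)) (⟦rep⟧ j)

    punctured₀-x⇔ : ∀ a → (J +S ⟨ G ⟩*) a ⇔ (G ∣ δ (x a) × a ≢ j)
    punctured₀-x⇔ a = ⇔.trans (CX.+S-isPuncturedCoset {d = 0ℤ} J CX.⟨⟩*-isPuncturedCoset a) (mk⇔
      (λ { (G∣ , a≢) → subst (G ∣_) (identity (rep a) J) G∣ , λ a≡j → a≢ (trans a≡j (sym ⟦J+0⟧≡j)) })
      (λ { (G∣ , a≢) → subst (G ∣_) (sym (identity (rep a) J)) G∣ , λ a≡ → a≢ (trans a≡ ⟦J+0⟧≡j) }))
      where
      identity : ∀ a J → a - (J + 0ℤ) ≡ a - J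
      identity = solve-∀

    punctured-x⇔ : ∀ e a → (e +S (J +S ⟨ G ⟩*)) a ⇔ (G ∣ δ (x a) - e × a ≢ ⟦ J + e ⟧)
    punctured-x⇔ e a = ⇔.trans (punctured-x e a) (mk⇔
      (λ (G∣ , a≢) → subst (G ∣_) (identity (rep a) J e) G∣ , λ a≡ → a≢ (trans a≡ (sym J+e≡)))
      (λ (G∣ , a≢) → subst (G ∣_) (sym (identity (rep a) J e)) G∣ , λ a≡ → a≢ (trans a≡ J+e≡)))
      where
      identity : ∀ a J e → a - (e + (J + 0ℤ)) ≡ a - J - e
      identity = solve-∀
      J+e≡ : ⟦_⟧ {Nx k} (e + (J + 0ℤ)) ≡ ⟦ J + e ⟧
      J+e≡ = cong ⟦_⟧ (identity′ J e)
        where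
        identity′ : ∀ J e → e + (J + 0ℤ) ≡ J + e
        identity′ = solve-∀

    punctured±1-x⇔ : ∀ a → (± + 1 +S (J +S ⟨ G ⟩*)) a ⇔ (δ (x a) ≡± 1 × ¬ Neighbour a)
    punctured±1-x⇔ a = ⇔.trans (punctured-x⇔ (+ 1) a ⊎-⇔ punctured-x⇔ (- + 1) a) (mk⇔
      Data.Sum.[ (λ (G∣ , a≢) → inj₁ G∣ , Data.Sum.[ a≢ , (λ a≡ → both-sides G∣ (≡⟦J+⟧⇒∣ (- + 1) a≡)) ])
               , (λ (G∣ , a≢) → inj₂ G∣ , Data.Sum.[ (λ a≡ → both-sides (≡⟦J+⟧⇒∣ (+ 1) a≡) G∣) , a≢ ]) ]
      (λ { (inj₁ G∣ , ¬nb) → inj₁ (G∣ , ¬nb ∘ inj₁) ; (inj₂ G∣ , ¬nb) → inj₂ (G∣ , ¬nb ∘ inj₂) }))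
      where
      both-sides : G ∣ δ (x a) - + 1 → ¬ G ∣ δ (x a) + + 1
      both-sides = ¬∣-s∧∣+s {δ (x a)} (s≤s z≤n) k≥1

    K : Sub (Ny k)
    K = ｛ + 0 ｝ ∪ ｛ + (2 N.* k N.+ 1) ｝ ∪ ｛ + (2 N.* k N.+ 3) ｝

    +S-K⇔ : ∀ c b → (c +S (J +S K)) b ⇔
            (b ≡ ⟦ c + J + + 0 ⟧ ⊎ b ≡ ⟦ c + J + G ⟧ ⊎ b ≡ ⟦ c + J + + (2 N.* k N.+ 3) ⟧)
    +S-K⇔ c b = ⇔.trans (+S-assoc c J b) (⇔.trans (+S-∪ (c + J) b)
      (+S-｛｝ (c + J) (+ 0) b ⊎-⇔ ⇔.trans (+S-∪ (c + J) b)
        (+S-｛｝ (c + J) G b ⊎-⇔ +S-｛｝ (c + J) (+ (2 N.* k N.+ 3)) b)))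

    ¬Ny∣G : ¬ + Ny k ∣ G
    ¬Ny∣G Ny∣G = contradiction (trans (sym g≡k+k+1) (ZP.+-injective (∣i∣<n∧n∣i⇒i≡0 g<Ny Ny∣G))) λ ()
      where
      Ny≡g+g : Ny k ≡ g N.+ g
      Ny≡g+g = identity k
        where
        identity : ∀ k → 2 N.+ 4 N.* k ≡ (2 N.* k N.+ 1) N.+ (2 N.* k N.+ 1)
        identity = NS.solve-∀
      g<Ny : g < Ny k
      g<Ny = subst (g <_) (sym Ny≡g+g) (NP.m<m+n g (subst (0 <_) (sym g≡k+k+1) (s≤s z≤n)))

    ≡⟦J+1+t⟧⇔Ny∣ : ∀ {b : Fin (Ny k)} w t → w ≡ J + + 1 + t → b ≡ ⟦ w ⟧ ⇔ (+ Ny k ∣ δ (y b) - t)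
    ≡⟦J+1+t⟧⇔Ny∣ {b} w t refl = ⇔.trans (≡⟦⟧⇔∣ w) (∣-resp-≡ (identity (rep b) J t))
      where
      identity : ∀ b J t → b - (J + + 1 + t) ≡ (b - + 1) - J - t
      identity = solve-∀

    ≡⟦J+3⟧⇔Ny∣ : ∀ b → b ≡ ⟦ J + + 3 ⟧ ⇔ (+ Ny k ∣ δ (y b) - + 2)
    ≡⟦J+3⟧⇔Ny∣ b = ≡⟦J+1+t⟧⇔Ny∣ (J + + 3) (+ 2) (sym (ZP.+-assoc J (+ 1) (+ 2)))

    G∣-t⇒G∣-t+G : ∀ {w} t t' → t - G ≡ t' → G ∣ w - t → G ∣ w - t'
    G∣-t⇒G∣-t+G {w} t t' refl G∣ = subst (G ∣_) (identity w t G) (∣m∣n⇒∣m+n G∣ (divides (+ 1) refl))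
      where
      identity : ∀ w t G → w - t + + 1 * G ≡ w - (t - G)
      identity = solve-∀

    K-translates : Fin (Ny k) → Set
    K-translates b =
      (+ Ny k ∣ δ (y b) - + 0 ⊎ + Ny k ∣ δ (y b) - G ⊎ + Ny k ∣ δ (y b) - (G + + 2)) ⊎
      (+ Ny k ∣ δ (y b) - - + 2 ⊎ + Ny k ∣ δ (y b) - (G - + 2) ⊎ + Ny k ∣ δ (y b) - G)

    ±1+J+K⇔K-translates : ∀ b → (± + 1 +S (J +S K)) b ⇔ K-translates b
    ±1+J+K⇔K-translates b = ⇔.trans (+S-K⇔ (+ 1) b ⊎-⇔ +S-K⇔ (- + 1) b)
      ((at (+ 0) (identity₁ J) ⊎-⇔ at G (identity₂ J G) ⊎-⇔ at (G + + 2) (viaE3 {+ 1} {G + + 2} (identity₃ J G))) ⊎-⇔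
       (at (- + 2) (identity₄ J) ⊎-⇔ at (G - + 2) (identity₅ J G) ⊎-⇔ at G (viaE3 { - + 1} {G} (identity₆ J G))))
      where
      at : ∀ {w} t → w ≡ J + + 1 + t → b ≡ ⟦ w ⟧ ⇔ (+ Ny k ∣ δ (y b) - t)
      at {w} t = ≡⟦J+1+t⟧⇔Ny∣ w t
      E3≡ : + (2 N.* k N.+ 3) ≡ G + + 2
      E3≡ = trans (+[ak+b] 2 3) (trans (identity kℤ) (cong (_+ + 2) (sym G≡2k+1)))
        where
        identity : ∀ k → + 2 * k + + 3 ≡ (+ 2 * k + + 1) + + 2
        identity = solve-∀
      viaE3 : ∀ {c t} → c + J + (G + + 2) ≡ J + + 1 + t → c + J + + (2 N.* k N.+ 3) ≡ J + + 1 + t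
      viaE3 {c} = trans (cong (λ e → c + J + e) E3≡)
      identity₁ : ∀ J → + 1 + J + + 0 ≡ J + + 1 + + 0
      identity₁ = solve-∀
      identity₂ : ∀ J G → + 1 + J + G ≡ J + + 1 + G
      identity₂ = solve-∀
      identity₃ : ∀ J G → + 1 + J + (G + + 2) ≡ J + + 1 + (G + + 2)
      identity₃ = solve-∀
      identity₄ : ∀ J → - + 1 + J + + 0 ≡ J + + 1 + - + 2
      identity₄ = solve-∀
      identity₅ : ∀ J G → - + 1 + J + G ≡ J + + 1 + (G - + 2)
      identity₅ = solve-∀
      identity₆ : ∀ J G → - + 1 + J + (G + + 2) ≡ J + + 1 + G
      identity₆ = solve-∀

    K-translates⇒ : ∀ {b} → K-translates b → G ∣ δ (y b) ⊎ (δ (y b) ≡± 2 × b ≢ ⟦ J + + 3 ⟧)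
    K-translates⇒ {b} (inj₁ (inj₁ Ny∣)) = inj₁ (subst (G ∣_) (ZP.+-identityʳ (δ (y b))) (Ny∣⇒G∣ Ny∣))
    K-translates⇒ {b} (inj₁ (inj₂ (inj₁ Ny∣))) =
      inj₁ (subst (G ∣_) (ZP.+-identityʳ (δ (y b))) (G∣-t⇒G∣-t+G {δ (y b)} G (+ 0) (ZP.+-inverseʳ G) (Ny∣⇒G∣ Ny∣)))
    K-translates⇒ {b} (inj₁ (inj₂ (inj₂ Ny∣))) = inj₂ (inj₁ (G∣-t⇒G∣-t+G {δ (y b)} (G + + 2) (+ 2)
        (identity G) (Ny∣⇒G∣ Ny∣)) , b≢)
      where
      identity : ∀ G → G + + 2 - G ≡ + 2
      identity = solve-∀
      cancel : ∀ δ G → (δ - + 2) - (δ - (G + + 2)) ≡ G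
      cancel = solve-∀
      b≢ : b ≢ ⟦ J + + 3 ⟧
      b≢ b≡ = ¬Ny∣G (subst (+ Ny k ∣_) (cancel (δ (y b)) G) (∣m∣n⇒∣m-n (to (≡⟦J+3⟧⇔Ny∣ b) b≡) Ny∣))
    K-translates⇒ {b} (inj₂ (inj₁ Ny∣)) = inj₂ (inj₂ (Ny∣⇒G∣ Ny∣) , λ b≡ → ¬∣-s∧∣+s {δ (y b)} (s≤s z≤n) k≥2
      (Ny∣⇒G∣ (to (≡⟦J+3⟧⇔Ny∣ b) b≡)) (Ny∣⇒G∣ Ny∣))
    K-translates⇒ {b} (inj₂ (inj₂ (inj₁ Ny∣))) = inj₂ (inj₂ G∣δ+2 , λ b≡ → ¬∣-s∧∣+s {δ (y b)} (s≤s z≤n) k≥2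
      (Ny∣⇒G∣ (to (≡⟦J+3⟧⇔Ny∣ b) b≡)) G∣δ+2)
      where
      identity : ∀ G → G - + 2 - G ≡ - + 2
      identity = solve-∀
      G∣δ+2 = G∣-t⇒G∣-t+G {δ (y b)} (G - + 2) (- + 2) (identity G) (Ny∣⇒G∣ Ny∣)
    K-translates⇒ {b} (inj₂ (inj₂ (inj₂ Ny∣))) =
      inj₁ (subst (G ∣_) (ZP.+-identityʳ (δ (y b))) (G∣-t⇒G∣-t+G {δ (y b)} G (+ 0) (ZP.+-inverseʳ G) (Ny∣⇒G∣ Ny∣)))

    ⇒K-translates : ∀ {b} → G ∣ δ (y b) ⊎ (δ (y b) ≡± 2 × b ≢ ⟦ J + + 3 ⟧) → K-translates b
    ⇒K-translates {b} (inj₁ G∣δ) with G∣⇒Ny∣⊎Ny∣-G G∣δ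
    ... | inj₁ Ny∣ = inj₁ (inj₁ (subst (+ Ny k ∣_) (sym (ZP.+-identityʳ (δ (y b)))) Ny∣))
    ... | inj₂ Ny∣ = inj₁ (inj₂ (inj₁ Ny∣))
    ⇒K-translates {b} (inj₂ (inj₁ G∣δ-2 , b≢)) with G∣⇒Ny∣⊎Ny∣-G G∣δ-2
    ... | inj₁ Ny∣ = contradiction (from (≡⟦J+3⟧⇔Ny∣ b) Ny∣) b≢
    ... | inj₂ Ny∣ = inj₁ (inj₂ (inj₂ (subst (+ Ny k ∣_) (identity (δ (y b)) G) Ny∣)))
      where
      identity : ∀ δ G → δ - + 2 - G ≡ δ - (G + + 2)
      identity = solve-∀
    ⇒K-translates {b} (inj₂ (inj₂ G∣δ+2 , _)) with G∣⇒Ny∣⊎Ny∣-G G∣δ+2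
    ... | inj₁ Ny∣ = inj₂ (inj₁ Ny∣)
    ... | inj₂ Ny∣ = inj₂ (inj₂ (inj₁ (subst (+ Ny k ∣_) (identity (δ (y b)) G) Ny∣)))
      where
      identity : ∀ δ G → δ + + 2 - G ≡ δ - (G - + 2)
      identity = solve-∀

    sphere₂-y⇔ : ∀ b → (± + 1 +S (J +S K)) b ⇔ (G ∣ δ (y b) ⊎ (δ (y b) ≡± 2 × b ≢ ⟦ J + + 3 ⟧))
    sphere₂-y⇔ b = ⇔.trans (±1+J+K⇔K-translates b) (mk⇔ K-translates⇒ ⇒K-translates)

    XDist₂⇔ : ∀ a → XDist a 2 ⇔ (δ (x a) ≡± 2 ⊎ (G ∣ δ (x a) × a ≢ j))
    XDist₂⇔ a = mk⇔ (λ { (same-level G∣δ a≢j) → inj₂ (G∣δ , a≢j) ; (level± _ _ δ≡±2) → inj₁ δ≡±2 })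
      Data.Sum.[ level± NP.≤-refl k≥2 , (λ (G∣δ , a≢j) → same-level G∣δ a≢j) ]

    XDist₃⇔ : ∀ a → XDist a 3 ⇔ (δ (x a) ≡± 3 ⊎ (δ (x a) ≡± 1 × ¬ Neighbour a))
    XDist₃⇔ a = mk⇔ (λ { (level±1 δ≡±1 ¬nb) → inj₂ (δ≡±1 , ¬nb) ; (level± _ _ δ≡±3) → inj₁ δ≡±3 })
      Data.Sum.[ level± (NP.n≤1+n 2) k≥3 , (λ (δ≡±1 , ¬nb) → level±1 δ≡±1 ¬nb) ]

    XDist₄⇔ : ∀ a → XDist a 4 ⇔ δ (x a) ≡± 4
    XDist₄⇔ a = mk⇔ (λ { (level± _ _ δ≡±4) → δ≡±4 }) (level± (s≤s (s≤s z≤n)) k≥4)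

    XDist-far⇔ : ∀ {i} a → 5 ≤ i → i ≤ k → XDist a i ⇔ δ (x a) ≡± i
    XDist-far⇔ a 5≤i i≤k = mk⇔ (far 5≤i) (level± (NP.≤-trans (s≤s (s≤s z≤n)) 5≤i) i≤k)
      where
      far : ∀ {i} → 5 ≤ i → XDist a i → δ (x a) ≡± i
      far () (at-j _)
      far (s≤s ()) (neighbour _)
      far (s≤s (s≤s ())) (same-level _ _)
      far (s≤s (s≤s (s≤s ()))) (level±1 _ _)
      far _ (level± _ _ δ≡±i) = δ≡±i

    YDist₂⇔ : ∀ b → YDist b 2 ⇔ (G ∣ δ (y b) ⊎ (δ (y b) ≡± 2 × b ≢ ⟦ J + + 3 ⟧))
    YDist₂⇔ b = mk⇔
      (λ { (same-level G∣δ) → inj₁ G∣δ ; (level±2 δ≡±2 b≢) → inj₂ (δ≡±2 , b≢) ; (level± (s≤s (s≤s ())) _ _) })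
      Data.Sum.[ same-level , (λ (δ≡±2 , b≢) → level±2 δ≡±2 b≢) ]

    YDist₃⇔ : ∀ b → YDist b 3 ⇔ (δ (y b) ≡± 3 ⊎ b ≡ ⟦ J + + 2 ⟧)
    YDist₃⇔ b = mk⇔ (λ { (at-J+2 b≡) → inj₂ b≡ ; (level± _ _ δ≡±3) → inj₁ δ≡±3 })
      Data.Sum.[ level± NP.≤-refl k≥3 , at-J+2 ]

    YDist₄⇔ : ∀ b → YDist b 4 ⇔ (δ (y b) ≡± 4 ⊎ b ≡ ⟦ J + + 3 ⟧)
    YDist₄⇔ b = mk⇔ (λ { (at-J+3 b≡) → inj₂ b≡ ; (level± _ _ δ≡±4) → inj₁ δ≡±4 })
      Data.Sum.[ level± (NP.n≤1+n 3) k≥4 , at-J+3 ]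

    YDist-far⇔ : ∀ {i} b → 5 ≤ i → i ≤ k → YDist b i ⇔ δ (y b) ≡± i
    YDist-far⇔ b 5≤i i≤k = mk⇔ (far 5≤i) (level± (NP.≤-trans (s≤s (s≤s (s≤s z≤n))) 5≤i) i≤k)
      where
      far : ∀ {i} → 5 ≤ i → YDist b i → δ (y b) ≡± i
      far (s≤s ()) (level±1 _ _)
      far (s≤s (s≤s ())) (same-level _)
      far (s≤s (s≤s ())) (level±2 _ _)
      far (s≤s (s≤s (s≤s ()))) (at-J+2 _)
      far (s≤s (s≤s (s≤s (s≤s ())))) (at-J+3 _)
      far _ (level± _ _ δ≡±i) = δ≡±i

    SphereIs-from : ∀ {i A B} → (∀ a → XDist a i ⇔ A a) → (∀ b → YDist b i ⇔ B b) → SphereIs k (x j) i A B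
    SphereIs-from {i} x-sphere y-sphere =
      (λ a → ⇔.trans (Dist-x⇔XDist a i) (x-sphere a)) , (λ b → ⇔.trans (Dist-y⇔YDist b i) (y-sphere b))

    sphere₂ : SphereIs k (x j) 2 ((± + 2 +S (J +S ⟨ G ⟩)) ∪ (J +S ⟨ G ⟩*)) (± + 1 +S (J +S K))
    sphere₂ = SphereIs-from
      (λ a → ⇔.trans (XDist₂⇔ a) (⇔.sym (±coset-x⇔ 2 a ⊎-⇔ punctured₀-x⇔ a)))
      (λ b → ⇔.trans (YDist₂⇔ b) (⇔.sym (sphere₂-y⇔ b)))

    sphere₃ : SphereIs k (x j) 3
      ((± + 3 +S (J +S ⟨ G ⟩)) ∪ (± + 1 +S (J +S ⟨ G ⟩*)))
      ((± + 3 +S (J +S (+ 1 +S ⟨ G ⟩))) ∪ ｛ J + + 2 ｝)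
    sphere₃ = SphereIs-from
      (λ a → ⇔.trans (XDist₃⇔ a) (⇔.sym (±coset-x⇔ 3 a ⊎-⇔ punctured±1-x⇔ a)))
      (λ b → ⇔.trans (YDist₃⇔ b) (⇔.sym (±coset-y⇔ 3 b ⊎-⇔ ⇔.refl)))

    sphere₄ : SphereIs k (x j) 4
      (± + 4 +S (J +S ⟨ G ⟩))
      ((± + 4 +S (J +S (+ 1 +S ⟨ G ⟩))) ∪ ｛ J + + 3 ｝)
    sphere₄ = SphereIs-from
      (λ a → ⇔.trans (XDist₄⇔ a) (⇔.sym (±coset-x⇔ 4 a)))
      (λ b → ⇔.trans (YDist₄⇔ b) (⇔.sym (±coset-y⇔ 4 b ⊎-⇔ ⇔.refl)))

    sphere-far : ∀ i → 5 ≤ i → i ≤ k →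
      SphereIs k (x j) i (± + i +S (J +S ⟨ G ⟩)) (± + i +S (J +S (+ 1 +S ⟨ G ⟩)))
    sphere-far i 5≤i i≤k = SphereIs-from
      (λ a → ⇔.trans (XDist-far⇔ a 5≤i i≤k) (⇔.sym (±coset-x⇔ i a)))
      (λ b → ⇔.trans (YDist-far⇔ b 5≤i i≤k) (⇔.sym (±coset-y⇔ i b)))

    module LX = CosetLists {Nx k} 3 G Nx≡4G
    module LY = CosetLists {Ny k} 1 G Ny≡2G

    ±coset-x-enum : ∀ s → 0 < s → s ≤ k →
      Enumerates (LX.cosetList (+ s + (J + 0ℤ)) ++ LX.cosetList (- + s + (J + 0ℤ))) (± + s +S (J +S ⟨ G ⟩))
    ±coset-x-enum s 0<s s≤k = Enumerates-∪
      (LX.cosetList-enumerates {d = + s + (J + 0ℤ)} (coset-x (+ s)))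
      (LX.cosetList-enumerates {d = - + s + (J + 0ℤ)} (coset-x (- + s)))
      (λ a p q → ¬∣-s∧∣+s {δ (x a)} 0<s s≤k (to (coset⁺-x⇔ s a) p) (to (coset⁻-x⇔ s a) q))

    ±coset-y-enum : ∀ s → 0 < s → s ≤ k →
      Enumerates (LY.cosetList (+ s + (J + (+ 1 + 0ℤ))) ++ LY.cosetList (- + s + (J + (+ 1 + 0ℤ))))
                 (± + s +S (J +S (+ 1 +S ⟨ G ⟩)))
    ±coset-y-enum s 0<s s≤k = Enumerates-∪
      (LY.cosetList-enumerates {d = + s + (J + (+ 1 + 0ℤ))} (coset-y (+ s)))
      (LY.cosetList-enumerates {d = - + s + (J + (+ 1 + 0ℤ))} (coset-y (- + s)))
      (λ b p q → ¬∣-s∧∣+s {δ (y b)} 0<s s≤k (to (coset⁺-y⇔ s b) p) (to (coset⁻-y⇔ s b) q))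

    sphere₂-x-enum : Enumerates
      ((LX.cosetList (+ 2 + (J + 0ℤ)) ++ LX.cosetList (- + 2 + (J + 0ℤ))) ++ LX.puncturedCosetList (J + 0ℤ))
      ((± + 2 +S (J +S ⟨ G ⟩)) ∪ (J +S ⟨ G ⟩*))
    sphere₂-x-enum = Enumerates-∪ (±coset-x-enum 2 (s≤s z≤n) k≥2)
      (LX.puncturedCosetList-enumerates {d = J + 0ℤ} (CX.+S-isPuncturedCoset {d = 0ℤ} J CX.⟨⟩*-isPuncturedCoset))
      (λ a p q → contradiction (≡±-unique {δ (x a)} (to (±coset-x⇔ 2 a) p)
        (∣⇒≡±0 (proj₁ (to (punctured₀-x⇔ a) q))) k≥2 z≤n) λ ())

    sphere₃-x-enum : Enumerates
      ((LX.cosetList (+ 3 + (J + 0ℤ)) ++ LX.cosetList (- + 3 + (J + 0ℤ))) ++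
       (LX.puncturedCosetList (+ 1 + (J + 0ℤ)) ++ LX.puncturedCosetList (- + 1 + (J + 0ℤ))))
      ((± + 3 +S (J +S ⟨ G ⟩)) ∪ (± + 1 +S (J +S ⟨ G ⟩*)))
    sphere₃-x-enum = Enumerates-∪ (±coset-x-enum 3 (s≤s z≤n) k≥3)
      (Enumerates-∪ (LX.puncturedCosetList-enumerates {d = + 1 + (J + 0ℤ)} (punctured-x (+ 1)))
                    (LX.puncturedCosetList-enumerates {d = - + 1 + (J + 0ℤ)} (punctured-x (- + 1)))
        (λ a p q → ¬∣-s∧∣+s {δ (x a)} (s≤s z≤n) k≥1
          (proj₁ (to (punctured-x⇔ (+ 1) a) p)) (proj₁ (to (punctured-x⇔ (- + 1) a) q))))
      (λ a p q → contradiction (≡±-unique {δ (x a)} (to (±coset-x⇔ 3 a) p)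
        (proj₁ (to (punctured±1-x⇔ a) q)) k≥3 k≥1) λ ())

    sphere₃-y-enum : Enumerates
      ((LY.cosetList (+ 3 + (J + (+ 1 + 0ℤ))) ++ LY.cosetList (- + 3 + (J + (+ 1 + 0ℤ)))) ++ [ ⟦ J + + 2 ⟧ ])
      ((± + 3 +S (J +S (+ 1 +S ⟨ G ⟩))) ∪ ｛ J + + 2 ｝)
    sphere₃-y-enum = Enumerates-∪ (±coset-y-enum 3 (s≤s z≤n) k≥3) (Enumerates-｛｝ (J + + 2))
      (λ b p b≡ → contradiction (≡±-unique {δ (y b)} (to (±coset-y⇔ 3 b) p) (≡⟦J+1+s⟧⇒≡±s 1 b≡) k≥3 k≥1) λ ())

    sphere₄-y-enum : Enumerates
      ((LY.cosetList (+ 4 + (J + (+ 1 + 0ℤ))) ++ LY.cosetList (- + 4 + (J + (+ 1 + 0ℤ)))) ++ [ ⟦ J + + 3 ⟧ ])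
      ((± + 4 +S (J +S (+ 1 +S ⟨ G ⟩))) ∪ ｛ J + + 3 ｝)
    sphere₄-y-enum = Enumerates-∪ (±coset-y-enum 4 (s≤s z≤n) k≥4) (Enumerates-｛｝ (J + + 3))
      (λ b p b≡ → contradiction (≡±-unique {δ (y b)} (to (±coset-y⇔ 4 b) p) (≡⟦J+1+s⟧⇒≡±s 2 b≡) k≥4 k≥2) λ ())

    sphere₂-y-enum : Enumerates
      (LY.cosetList (J + + 1) ++ (LY.puncturedCosetList (J + + 3) ++ LY.cosetList (J - + 1)))
      (± + 1 +S (J +S K))
    sphere₂-y-enum = Enumerates-resp (λ b → ⇔.trans (regroup b) (⇔.sym (sphere₂-y⇔ b)))
      (Enumerates-∪ (LY.cosetList-enumerates {d = J + + 1} level₀)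
        (Enumerates-∪ (LY.puncturedCosetList-enumerates {d = J + + 3} level₂)
                      (LY.cosetList-enumerates {d = J - + 1} level₋₂)
          (λ b (G∣ , _) G∣′ → ¬∣-s∧∣+s {δ (y b)} (s≤s z≤n) k≥2 G∣ G∣′))
        (λ b G∣ p → contradiction (≡±-unique {δ (y b)} (∣⇒≡±0 G∣) (in-level±2 b p) z≤n k≥2) λ ()))
      where
      identity₀ : ∀ b J → (b - + 1) - J ≡ b - (J + + 1)
      identity₀ = solve-∀
      identity₂ : ∀ b J → (b - + 1) - J - + 2 ≡ b - (J + + 3)
      identity₂ = solve-∀
      identity₋₂ : ∀ b J → (b - + 1) - J + + 2 ≡ b - (J - + 1)
      identity₋₂ = solve-∀
      level₀ : CY.IsCoset (λ b → G ∣ δ (y b)) (J + + 1)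
      level₀ b = ∣-resp-≡ (identity₀ (rep b) J)
      level₂ : CY.IsPuncturedCoset (λ b → G ∣ δ (y b) - + 2 × b ≢ ⟦ J + + 3 ⟧) (J + + 3)
      level₂ b = ∣-resp-≡ (identity₂ (rep b) J) ×-⇔ ⇔.refl
      level₋₂ : CY.IsCoset (λ b → G ∣ δ (y b) + + 2) (J - + 1)
      level₋₂ b = ∣-resp-≡ (identity₋₂ (rep b) J)
      in-level±2 : ∀ b → (G ∣ δ (y b) - + 2 × b ≢ ⟦ J + + 3 ⟧) ⊎ G ∣ δ (y b) + + 2 → δ (y b) ≡± 2
      in-level±2 b = Data.Sum.map proj₁ (λ G∣ → G∣)
      regroup : ∀ b → (G ∣ δ (y b) ⊎ (G ∣ δ (y b) - + 2 × b ≢ ⟦ J + + 3 ⟧) ⊎ G ∣ δ (y b) + + 2) ⇔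
                      (G ∣ δ (y b) ⊎ (δ (y b) ≡± 2 × b ≢ ⟦ J + + 3 ⟧))
      regroup b = ⇔.refl ⊎-⇔ mk⇔
        Data.Sum.[ (λ (G∣ , b≢) → inj₁ G∣ , b≢)
                 , (λ G∣ → inj₂ G∣ , λ b≡ → ¬∣-s∧∣+s {δ (y b)} (s≤s z≤n) k≥2
                     (≡⟦J+1+s⟧⇒∣ 2 b≡) G∣) ]
        (λ { (inj₁ G∣ , b≢) → inj₁ (G∣ , b≢) ; (inj₂ G∣ , _) → inj₂ G∣ })

    size₂ : SphereSize k (x j) 2 16
    size₂ = SphereIs⇒SphereSize sphere₂ sphere₂-x-enum sphere₂-y-enum

    size₃ : SphereSize k (x j) 3 19
    size₃ = SphereIs⇒SphereSize sphere₃ sphere₃-x-enum sphere₃-y-enum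

    size₄ : SphereSize k (x j) 4 13
    size₄ = SphereIs⇒SphereSize sphere₄ (±coset-x-enum 4 (s≤s z≤n) k≥4) sphere₄-y-enum

    size-far : ∀ i → 5 ≤ i → i ≤ k → SphereSize k (x j) i 12
    size-far i 5≤i i≤k = SphereIs⇒SphereSize (sphere-far i 5≤i i≤k)
      (±coset-x-enum i 0<i i≤k) (±coset-y-enum i 0<i i≤k)
      where
      0<i = NP.≤-trans (s≤s z≤n) 5≤i

    XDist≤k : ∀ {a d} → XDist a d → d ≤ k
    XDist≤k (at-j _)         = z≤n
    XDist≤k (neighbour _)    = k≥1
    XDist≤k (same-level _ _) = k≥2
    XDist≤k (level±1 _ _)    = k≥3
    XDist≤k (level± _ s≤k _) = s≤k

    YDist≤k : ∀ {b d} → YDist b d → d ≤ k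
    YDist≤k (same-level _)   = k≥2
    YDist≤k (level±1 _ _)    = k≥1
    YDist≤k (at-J+2 _)       = k≥3
    YDist≤k (level±2 _ _)    = k≥2
    YDist≤k (at-J+3 _)       = k≥4
    YDist≤k (level± _ s≤k _) = s≤k

    eccentricity : Ecc k (x j) k
    eccentricity = within-k , x ⟦ J + + k ⟧ , XDist⇒Dist (level± k≥2 NP.≤-refl (inj₁ (≡⟦J+⟧⇒∣ (+ k) refl)))
      where
      within-k : ∀ v → ∃[ d ] (d ≤ k × Dist k (x j) v d)
      within-k (x a) = let (d , xd) = classify-x a in d , XDist≤k xd , XDist⇒Dist xd
      within-k (y b) = let (d , yd) = classify-y b in d , YDist≤k yd , YDist⇒Dist yd

lemma3p12 : (k : ℕ) → 5 ≤ k → (j : Fin (Nx k)) →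
  let J = rep j
      g = + (2 N.* k N.+ 1)
      K : Sub (Ny k)
      K = ｛ + 0 ｝ ∪ ｛ + (2 N.* k N.+ 1) ｝ ∪ ｛ + (2 N.* k N.+ 3) ｝
  in SphereIs k (x j) 2
       ((± + 2 +S (J +S ⟨ g ⟩)) ∪ (J +S ⟨ g ⟩*))
       (± + 1 +S (J +S K))
   × SphereIs k (x j) 3
       ((± + 3 +S (J +S ⟨ g ⟩)) ∪ (± + 1 +S (J +S ⟨ g ⟩*)))
       ((± + 3 +S (J +S (+ 1 +S ⟨ g ⟩))) ∪ ｛ J + + 2 ｝)
   × SphereIs k (x j) 4
       (± + 4 +S (J +S ⟨ g ⟩))
       ((± + 4 +S (J +S (+ 1 +S ⟨ g ⟩))) ∪ ｛ J + + 3 ｝)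
   × (∀ i → 5 ≤ i → i ≤ k →
        SphereIs k (x j) i
          (± + i +S (J +S ⟨ g ⟩))
          (± + i +S (J +S (+ 1 +S ⟨ g ⟩))))
   × (SphereSize k (x j) 2 16
      × SphereSize k (x j) 3 19
      × SphereSize k (x j) 4 13
      × (∀ i → 5 ≤ i → i ≤ k → SphereSize k (x j) i 12)
      × Ecc k (x j) k)
lemma3p12 k k≥5 j =
  sphere₂ , sphere₃ , sphere₄ , sphere-far , size₂ , size₃ , size₄ , size-far , eccentricity
  where open Γ.Distances k k≥5 j
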